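{- Let $t \geq 1$ and let $G$ be a connected $2t$-regular graph. Then $o_v(\mathcal{M}_3(G)) = 2\,o_v(G)$ and $o_e(\mathcal{M}_3(G)) = o_e(G) + 2\,o_v(G)$. Moreover, $|\mathrm{Aut}(\mathcal{M}_3(G))| = (2^t\, t!)^{|V(G)|}\, |\mathrm{Aut}(G)|$.
   Context: $\mathcal{M}_3(G)$ is the graph obtained from $G$ by fusing a bouquet of $t$ triangles to every vertex of $G$: for each vertex $v$ of $G$ and each of $t$ copies, add two new vertices adjacent to each other and to $v$ (all new vertices distinct). $\mathrm{Aut}(H)$ denotes the full automorphism group of a graph $H$, and $o_v(H)$, $o_e(H)$ the numbers of its orbits on vertices and on edges. -}

module Defs where

open import Data.Nat using (ℕ; zero; suc; _+_; _*_; _<ᵇ_)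
open import Data.Bool using (Bool; true; false; _∧_; _∨_; not; if_then_else_)
import Data.Bool.Properties as BoolP
open import Data.Fin using (Fin; zero; suc; toℕ; remQuot)
import Data.Fin.Properties as FinP
open import Data.Product using (_×_; _,_)
open import Data.List using (List; []; _∷_; concatMap; map; length; filterᵇ)
open import Data.Bool.ListAction using (any)
open import Relation.Binary.PropositionalEquality using (_≡_)
open import Relation.Nullary.Decidable using (⌊_⌋)

Adj : ℕ → Set
Adj n = Fin n → Fin n → Bool

record IsSimpleGraph {n : ℕ} (G : Adj n) : Set where
  field
    symmetric : ∀ u v → G u v ≡ G v u
    loopless  : ∀ v → G v v ≡ false

_==ᶠ_ : ∀ {n} → Fin n → Fin n → Bool
i ==ᶠ j = ⌊ i FinP.≟ j ⌋

_==ᵇ_ : Bool → Bool → Bool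
a ==ᵇ b = ⌊ a BoolP.≟ b ⌋

allFin : ∀ n → (Fin n → Bool) → Bool
allFin zero    p = true
allFin (suc n) p = p zero ∧ allFin n (λ i → p (suc i))

anyFin : ∀ n → (Fin n → Bool) → Bool
anyFin zero    p = false
anyFin (suc n) p = p zero ∨ anyFin n (λ i → p (suc i))

sumFin : ∀ n → (Fin n → ℕ) → ℕ
sumFin zero    f = 0
sumFin (suc n) f = f zero + sumFin n (λ i → f (suc i))

countFin : ∀ n → (Fin n → Bool) → ℕ
countFin zero    p = 0
countFin (suc n) p = (if p zero then 1 else 0) + countFin n (λ i → p (suc i))

degree : ∀ {n} → Adj n → Fin n → ℕ
degree {n} G v = countFin n (λ w → G v w)

Regular : ∀ {n} → ℕ → Adj n → Set
Regular {n} d G = ∀ v → degree G v ≡ d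

data Walk {n : ℕ} (G : Adj n) : Fin n → Fin n → Set where
  here : ∀ {v} → Walk G v v
  step : ∀ {u w v} → G u w ≡ true → Walk G w v → Walk G u v

Connected : ∀ {n} → Adj n → Set
Connected {n} G = ∀ (u v : Fin n) → Walk G u v

allIdx : ∀ k → List (Fin k)
allIdx zero    = []
allIdx (suc k) = zero ∷ map suc (allIdx k)

allFuns : ∀ m k → List (Fin m → Fin k)
allFuns zero    k = (λ ()) ∷ []
allFuns (suc m) k =
  concatMap (λ i → map (λ g → λ { zero → i ; (suc x) → g x }) (allFuns m k))
            (allIdx k)

-- f is an automorphism of G: injective (hence bijective on Fin n) and
-- u ~ v  iff  f u ~ f v.
isAut : ∀ {n} → Adj n → (Fin n → Fin n) → Bool
isAut {n} G f =
  allFin n (λ u → allFin n (λ v →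
    (G (f u) (f v) ==ᵇ G u v) ∧ (not (f u ==ᶠ f v) ∨ (u ==ᶠ v))))

autList : ∀ {n} → Adj n → List (Fin n → Fin n)
autList {n} G = filterᵇ (isAut G) (allFuns n n)

autOrder : ∀ {n} → Adj n → ℕ
autOrder G = length (autList G)

sameVertexOrbit : ∀ {n} → Adj n → Fin n → Fin n → Bool
sameVertexOrbit G u v = any (λ f → f u ==ᶠ v) (autList G)

-- o_v(G): number of vertex orbits, counted via their least elements
vertexOrbits : ∀ {n} → Adj n → ℕ
vertexOrbits {n} G =
  countFin n (λ v → not (anyFin n (λ u → (toℕ u <ᵇ toℕ v) ∧ sameVertexOrbit G u v)))

-- edges are represented by pairs (u , v) with u < v and G u v
isEdge : ∀ {n} → Adj n → Fin n → Fin n → Bool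
isEdge G u v = (toℕ u <ᵇ toℕ v) ∧ G u v

sameEdgeOrbit : ∀ {n} → Adj n → Fin n → Fin n → Fin n → Fin n → Bool
sameEdgeOrbit G u v x y =
  any (λ f → ((f u ==ᶠ x) ∧ (f v ==ᶠ y)) ∨ ((f u ==ᶠ y) ∧ (f v ==ᶠ x))) (autList G)

lexLt : ∀ {n} → Fin n → Fin n → Fin n → Fin n → Bool
lexLt u v x y = (toℕ u <ᵇ toℕ x) ∨ ((u ==ᶠ x) ∧ (toℕ v <ᵇ toℕ y))

-- o_e(G): number of edge orbits, counted via their lexicographically least edges
edgeOrbits : ∀ {n} → Adj n → ℕ
edgeOrbits {n} G =
  sumFin n (λ x → countFin n (λ y → isEdge G x y ∧
    not (anyFin n (λ u → anyFin n (λ v →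
      isEdge G u v ∧ lexLt u v x y ∧ sameEdgeOrbit G u v x y)))))

-- M_3(G): fuse a bouquet of t triangles at every vertex of G.
-- Vertex set Fin (n * (1 + 2t)); via remQuot a vertex is a pair (v , j)
-- with v : Fin n, j : Fin (1 + 2t).  j = zero is the original vertex v;
-- j = suc j' with remQuot 2 j' = (c , b) is vertex b ∈ {0,1} of the c-th
-- triangle (c : Fin t) attached at v.

M3 : ∀ {n} (t : ℕ) → Adj n → Adj (n * suc (t * 2))
M3 {n} t G p q with remQuot {n} (suc (t * 2)) p | remQuot {n} (suc (t * 2)) q
... | v , zero   | w , zero   = G v w
... | v , zero   | w , suc _  = v ==ᶠ w
... | v , suc _  | w , zero   = v ==ᶠ w
... | v , suc j  | w , suc k  with remQuot {t} 2 j | remQuot {t} 2 k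
...   | c , b | d , e = (v ==ᶠ w) ∧ (c ==ᶠ d) ∧ not (b ==ᶠ e)

-- In M3 t G an original vertex has a G-neighbour and a triangle vertex
-- as non-adjacent neighbours, whereas the neighbourhood of a triangle vertex is a
-- clique.  Hence every automorphism maps original vertices to original vertices and
-- restricts to an automorphism σ of G; adjacency to the original vertex then maps the
-- bouquet at v onto the bouquet at σ v, preserving its triangles, i.e. by one of the
-- 2^t t! hyperoctahedral maps.  Conversely σ together with an arbitrary choice of such
-- maps at every vertex is an automorphism, which gives the order of Aut(M3 t G).
-- The hyperoctahedral maps act transitively on the triangle vertices and on the
-- triangle bases of a bouquet, so over every vertex orbit of G there are exactly two
-- vertex orbits (original, triangle) and two new edge orbits (spokes, bases).

module Submission where

open import Defs
open import Data.Nat using (ℕ; zero; suc; _+_; _*_; _^_; _≥_; _!; _<_; _≤_; _<ᵇ_; z≤n; s≤s)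
import Data.Nat.Properties as ℕ
open import Algebra.Properties.CommutativeSemigroup ℕ.+-commutativeSemigroup
  using () renaming (interchange to +-interchange)
open import Data.Bool using (Bool; true; false; _∧_; _∨_; not; if_then_else_) renaming (_≟_ to _≟ᵇ_)
open import Data.Bool.Properties using (∧-conicalˡ; ∧-conicalʳ; ∧-zeroʳ; ∧-identityʳ; not-injective; T-≡)
open import Data.Bool.ListAction using (any)
open import Data.Empty using (⊥-elim)
open import Data.Fin using (Fin; zero; suc; toℕ; remQuot; combine; punchIn; punchOut; _↑ˡ_; _↑ʳ_)
import Data.Fin.Properties as Fin
import Data.Fin.Permutation.Components as PC
open import Data.List using (List; []; _∷_; concatMap; map; length; filterᵇ; _++_)
open import Data.Product using (_×_; _,_; proj₁; proj₂; map₂; ∃-syntax)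
open import Data.Sum using (_⊎_; inj₁; inj₂; [_,_])
open import Data.Vec.Functional using () renaming (_∷_ to _∷ᶠ_)
open import Function using (id; _∘_)
open import Function.Bundles using (Equivalence)
open import Function.Definitions using (Injective)
open import Relation.Binary.Definitions using (tri<; tri≈; tri>)
open import Relation.Binary.PropositionalEquality
  using (_≡_; _≢_; refl; sym; trans; cong; cong₂; subst; subst₂; module ≡-Reasoning)
open import Relation.Nullary using (¬_; yes; no)

-- Boolean reflection and finite sums

indicator : Bool → ℕ
indicator b = if b then 1 else 0

bool-ext : ∀ {a b : Bool} → (a ≡ true → b ≡ true) → (b ≡ true → a ≡ true) → a ≡ b
bool-ext {false} {false} _ _ = refl
bool-ext {false} {true}  _ g = g refl
bool-ext {true}  {false} f _ = sym (f refl)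
bool-ext {true}  {true}  _ _ = refl

true≢false : ∀ {a} → a ≡ true → a ≢ false
true≢false refl ()

¬true⇒false : ∀ {a} → ¬ (a ≡ true) → a ≡ false
¬true⇒false {false} _ = refl
¬true⇒false {true}  h = ⊥-elim (h refl)

not-true⇒false : ∀ {a} → not a ≡ true → a ≡ false
not-true⇒false = not-injective

∧-intro : ∀ {a b} → a ≡ true → b ≡ true → a ∧ b ≡ true
∧-intro refl refl = refl

∧-elimˡ : ∀ a {b} → a ∧ b ≡ true → a ≡ true
∧-elimˡ a = ∧-conicalˡ a _

∧-elimʳ : ∀ a {b} → a ∧ b ≡ true → b ≡ true
∧-elimʳ a = ∧-conicalʳ a _

∨-elim : ∀ a {b} → a ∨ b ≡ true → a ≡ true ⊎ b ≡ true
∨-elim true  _ = inj₁ refl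
∨-elim false e = inj₂ e

∨-introˡ : ∀ {a} b → a ≡ true → a ∨ b ≡ true
∨-introˡ b refl = refl

∨-introʳ : ∀ a {b} → b ≡ true → a ∨ b ≡ true
∨-introʳ true  _ = refl
∨-introʳ false e = e

module _ {n : ℕ} {i j : Fin n} where

  ==ᶠ⇒≡ : i ==ᶠ j ≡ true → i ≡ j
  ==ᶠ⇒≡ e with i Fin.≟ j
  ... | yes p = p

  ≡⇒==ᶠ : i ≡ j → i ==ᶠ j ≡ true
  ≡⇒==ᶠ p with i Fin.≟ j
  ... | yes _ = refl
  ... | no ¬p = ⊥-elim (¬p p)

  ≢⇒==ᶠ-false : i ≢ j → i ==ᶠ j ≡ false
  ≢⇒==ᶠ-false ¬p = ¬true⇒false (¬p ∘ ==ᶠ⇒≡)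

==ᶠ-refl : ∀ {n} (i : Fin n) → i ==ᶠ i ≡ true
==ᶠ-refl i = ≡⇒==ᶠ refl

==ᵇ⇒≡ : ∀ {a b} → a ==ᵇ b ≡ true → a ≡ b
==ᵇ⇒≡ {a} {b} e with a ≟ᵇ b
... | yes p = p

≡⇒==ᵇ : ∀ {a b} → a ≡ b → a ==ᵇ b ≡ true
≡⇒==ᵇ {a} {b} p with a ≟ᵇ b
... | yes _ = refl
... | no ¬p = ⊥-elim (¬p p)

<ᵇ⇒< : ∀ {m n} → (m <ᵇ n) ≡ true → m < n
<ᵇ⇒< {m} {n} = ℕ.<ᵇ⇒< m n ∘ Equivalence.from T-≡

<⇒<ᵇ : ∀ {m n} → m < n → (m <ᵇ n) ≡ true
<⇒<ᵇ = Equivalence.to T-≡ ∘ ℕ.<⇒<ᵇ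

allFin⇒ : ∀ n {p : Fin n → Bool} → allFin n p ≡ true → ∀ i → p i ≡ true
allFin⇒ (suc n) {p} e zero    = ∧-elimˡ (p zero) e
allFin⇒ (suc n) {p} e (suc i) = allFin⇒ n (∧-elimʳ (p zero) e) i

allFin-intro : ∀ n {p : Fin n → Bool} → (∀ i → p i ≡ true) → allFin n p ≡ true
allFin-intro zero    h = refl
allFin-intro (suc n) h = ∧-intro (h zero) (allFin-intro n (λ i → h (suc i)))

anyFin⇒ : ∀ n {p : Fin n → Bool} → anyFin n p ≡ true → ∃[ i ] p i ≡ true
anyFin⇒ (suc n) {p} e with ∨-elim (p zero) e
... | inj₁ p₀ = zero , p₀
... | inj₂ rest with anyFin⇒ n rest
...   | i , pᵢ = suc i , pᵢ

anyFin-intro : ∀ n {p : Fin n → Bool} (i : Fin n) → p i ≡ true → anyFin n p ≡ true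
anyFin-intro (suc n) {p} zero    e = ∨-introˡ (anyFin n (λ i → p (suc i))) e
anyFin-intro (suc n) {p} (suc i) e = ∨-introʳ (p zero) (anyFin-intro n i e)

anyFin-false : ∀ n {p : Fin n → Bool} → (∀ i → p i ≡ false) → anyFin n p ≡ false
anyFin-false n h = ¬true⇒false (λ e → let i , pᵢ = anyFin⇒ n e in true≢false pᵢ (h i))

allFin-cong : ∀ n {p q : Fin n → Bool} → (∀ i → p i ≡ q i) → allFin n p ≡ allFin n q
allFin-cong zero    h = refl
allFin-cong (suc n) h = cong₂ _∧_ (h zero) (allFin-cong n (λ i → h (suc i)))

sumFin-cong : ∀ n {f g : Fin n → ℕ} → (∀ i → f i ≡ g i) → sumFin n f ≡ sumFin n g
sumFin-cong zero    h = refl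
sumFin-cong (suc n) h = cong₂ _+_ (h zero) (sumFin-cong n (λ i → h (suc i)))

countFin-cong : ∀ n {p q : Fin n → Bool} → (∀ i → p i ≡ q i) → countFin n p ≡ countFin n q
countFin-cong zero    h = refl
countFin-cong (suc n) h = cong₂ _+_ (cong indicator (h zero)) (countFin-cong n (λ i → h (suc i)))

countFin≡sumFin : ∀ n (p : Fin n → Bool) → countFin n p ≡ sumFin n (λ i → indicator (p i))
countFin≡sumFin zero    p = refl
countFin≡sumFin (suc n) p = cong (indicator (p zero) +_) (countFin≡sumFin n (λ i → p (suc i)))

sumFin-+ : ∀ n (f g : Fin n → ℕ) → sumFin n (λ i → f i + g i) ≡ sumFin n f + sumFin n g
sumFin-+ zero    f g = refl
sumFin-+ (suc n) f g = begin
  f zero + g zero + sumFin n (λ i → f (suc i) + g (suc i))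
    ≡⟨ cong (f zero + g zero +_) (sumFin-+ n (λ i → f (suc i)) (λ i → g (suc i))) ⟩
  f zero + g zero + (sumFin n (λ i → f (suc i)) + sumFin n (λ i → g (suc i)))
    ≡⟨ +-interchange (f zero) (g zero) _ _ ⟩
  f zero + sumFin n (λ i → f (suc i)) + (g zero + sumFin n (λ i → g (suc i))) ∎
  where open ≡-Reasoning

sumFin-*ˡ : ∀ n k (f : Fin n → ℕ) → sumFin n (λ i → k * f i) ≡ k * sumFin n f
sumFin-*ˡ zero    k f = sym (ℕ.*-zeroʳ k)
sumFin-*ˡ (suc n) k f = trans (cong (k * f zero +_) (sumFin-*ˡ n k (λ i → f (suc i))))
                              (sym (ℕ.*-distribˡ-+ k (f zero) _))

sumFin-zero : ∀ n (f : Fin n → ℕ) → (∀ i → f i ≡ 0) → sumFin n f ≡ 0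
sumFin-zero zero    f h = refl
sumFin-zero (suc n) f h = cong₂ _+_ (h zero) (sumFin-zero n _ (λ i → h (suc i)))

sumFin-single : ∀ n (f : Fin n → ℕ) (v : Fin n) → (∀ i → i ≢ v → f i ≡ 0) → sumFin n f ≡ f v
sumFin-single (suc n) f zero h =
  trans (cong (f zero +_) (sumFin-zero n _ (λ i → h (suc i) (λ ())))) (ℕ.+-identityʳ _)
sumFin-single (suc n) f (suc v) h =
  cong₂ _+_ (h zero (λ ()))
            (sumFin-single n (λ i → f (suc i)) v (λ i i≢v → h (suc i) (i≢v ∘ Fin.suc-injective)))

sumFin-++ : ∀ a b (f : Fin (a + b) → ℕ) →
            sumFin (a + b) f ≡ sumFin a (λ i → f (i ↑ˡ b)) + sumFin b (λ j → f (a ↑ʳ j))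
sumFin-++ zero    b f = refl
sumFin-++ (suc a) b f = trans (cong (f zero +_) (sumFin-++ a b (λ i → f (suc i))))
                              (sym (ℕ.+-assoc (f zero) _ _))

sumFin-combine : ∀ n K (f : Fin (n * K) → ℕ) →
                 sumFin (n * K) f ≡ sumFin n (λ v → sumFin K (λ j → f (combine {n} v j)))
sumFin-combine zero    K f = refl
sumFin-combine (suc n) K f = trans (sumFin-++ K (n * K) f)
  (cong (sumFin K (λ j → f (combine {suc n} zero j)) +_) (sumFin-combine n K (λ x → f (K ↑ʳ x))))

countFin-combine : ∀ n K (p : Fin (n * K) → Bool) →
                   countFin (n * K) p ≡ sumFin n (λ v → countFin K (λ j → p (combine {n} v j)))
countFin-combine n K p = trans (countFin≡sumFin (n * K) p)
  (trans (sumFin-combine n K (λ x → indicator (p x))) (sumFin-cong n (λ v → sym (countFin≡sumFin K _))))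

countFin-nonzero : ∀ n (p : Fin n → Bool) → countFin n p ≢ 0 → ∃[ i ] p i ≡ true
countFin-nonzero zero    p h = ⊥-elim (h refl)
countFin-nonzero (suc n) p h with p zero in e
... | true  = zero , e
... | false with countFin-nonzero n (λ i → p (suc i)) h
...   | i , pᵢ = suc i , pᵢ

countFin-single : ∀ n (p : Fin n → Bool) (v : Fin n) → (∀ i → i ≢ v → p i ≡ false) →
                  countFin n p ≡ indicator (p v)
countFin-single n p v h =
  trans (countFin≡sumFin n p) (sumFin-single n _ v (λ i i≢v → cong indicator (h i i≢v)))

countFin-none : ∀ n (p : Fin n → Bool) → (∀ i → p i ≡ false) → countFin n p ≡ 0
countFin-none n p h = trans (countFin≡sumFin n p) (sumFin-zero n _ (λ i → cong indicator (h i)))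

countFin-at : ∀ n (v : Fin n) (F : Bool → Bool) → F false ≡ false →
              countFin n (λ w → F (w ==ᶠ v)) ≡ indicator (F true)
countFin-at n v F F-false =
  trans (countFin-single n _ v (λ w w≢v → trans (cong F (≢⇒==ᶠ-false w≢v)) F-false))
        (cong (indicator ∘ F) (==ᶠ-refl v))

module _ {m n : ℕ} where

  combine-monoʳ-< : ∀ (i : Fin m) {j k : Fin n} → toℕ j < toℕ k → toℕ (combine i j) < toℕ (combine i k)
  combine-monoʳ-< i {j} {k} j<k rewrite Fin.toℕ-combine i j | Fin.toℕ-combine i k = ℕ.+-monoʳ-< (n * toℕ i) j<k

  combine-cancelˡ-< : ∀ (i : Fin m) {j k : Fin n} → toℕ (combine i j) < toℕ (combine i k) → toℕ j < toℕ k
  combine-cancelˡ-< i {j} {k} lt rewrite Fin.toℕ-combine i j | Fin.toℕ-combine i k =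
    ℕ.+-cancelˡ-< (n * toℕ i) _ _ lt

  combine-<⇒ : ∀ (i : Fin m) (j : Fin n) (i′ : Fin m) (k : Fin n) → toℕ (combine i j) < toℕ (combine i′ k) →
               toℕ i < toℕ i′ ⊎ (i ≡ i′ × toℕ j < toℕ k)
  combine-<⇒ i j i′ k lt with ℕ.<-cmp (toℕ i) (toℕ i′)
  ... | tri< i<i′ _ _ = inj₁ i<i′
  ... | tri> _ _ i′<i = ⊥-elim (ℕ.<-asym lt (Fin.combine-monoˡ-< k j i′<i))
  ... | tri≈ _ i≡i′ _ with refl ← Fin.toℕ-injective i≡i′ = inj₂ (refl , combine-cancelˡ-< i lt)

-- Counting through enumerations

module _ {A : Set} where

  count : (A → Bool) → List A → ℕ
  count p []       = 0
  count p (x ∷ xs) = indicator (p x) + count p xs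

  sumBy : (A → ℕ) → List A → ℕ
  sumBy f []       = 0
  sumBy f (x ∷ xs) = f x + sumBy f xs

  length-filterᵇ : ∀ (p : A → Bool) xs → length (filterᵇ p xs) ≡ count p xs
  length-filterᵇ p [] = refl
  length-filterᵇ p (x ∷ xs) with p x
  ... | true  = cong suc (length-filterᵇ p xs)
  ... | false = length-filterᵇ p xs

  count-cong : ∀ {p q : A → Bool} xs → (∀ x → p x ≡ q x) → count p xs ≡ count q xs
  count-cong []       h = refl
  count-cong (x ∷ xs) h = cong₂ _+_ (cong indicator (h x)) (count-cong xs h)

  sumBy-cong : ∀ {f g : A → ℕ} xs → (∀ x → f x ≡ g x) → sumBy f xs ≡ sumBy g xs
  sumBy-cong []       h = refl
  sumBy-cong (x ∷ xs) h = cong₂ _+_ (h x) (sumBy-cong xs h)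

  count≡sumBy : ∀ (p : A → Bool) xs → count p xs ≡ sumBy (λ x → indicator (p x)) xs
  count≡sumBy p []       = refl
  count≡sumBy p (x ∷ xs) = cong (indicator (p x) +_) (count≡sumBy p xs)

  count-++ : ∀ (p : A → Bool) xs ys → count p (xs ++ ys) ≡ count p xs + count p ys
  count-++ p []       ys = refl
  count-++ p (x ∷ xs) ys = trans (cong (indicator (p x) +_) (count-++ p xs ys))
                                 (sym (ℕ.+-assoc (indicator (p x)) _ _))

  sumBy-zero : ∀ xs → sumBy (λ _ → 0) xs ≡ 0
  sumBy-zero []       = refl
  sumBy-zero (_ ∷ xs) = sumBy-zero xs

  sumBy-+ : ∀ (f g : A → ℕ) xs → sumBy (λ x → f x + g x) xs ≡ sumBy f xs + sumBy g xs
  sumBy-+ f g []       = refl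
  sumBy-+ f g (x ∷ xs) = trans (cong (f x + g x +_) (sumBy-+ f g xs)) (+-interchange (f x) (g x) _ _)

  sumBy-*ʳ : ∀ (f : A → ℕ) k xs → sumBy (λ x → f x * k) xs ≡ sumBy f xs * k
  sumBy-*ʳ f k []       = refl
  sumBy-*ʳ f k (x ∷ xs) = trans (cong (f x * k +_) (sumBy-*ʳ f k xs)) (sym (ℕ.*-distribʳ-+ k (f x) _))

  count-none : ∀ (p : A → Bool) xs → (∀ x → p x ≡ false) → count p xs ≡ 0
  count-none p []       h = refl
  count-none p (x ∷ xs) h = cong₂ _+_ (cong indicator (h x)) (count-none p xs h)

  count-∧ˡ : ∀ (c : Bool) (q : A → Bool) xs → count (λ x → c ∧ q x) xs ≡ indicator c * count q xs
  count-∧ˡ true  q xs = sym (ℕ.+-identityʳ _)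
  count-∧ˡ false q xs = count-none _ xs (λ _ → refl)

  count-mono : ∀ (p q : A → Bool) xs → (∀ x → p x ≡ true → q x ≡ true) → count p xs ≤ count q xs
  count-mono p q []       h = z≤n
  count-mono p q (x ∷ xs) h with p x in px | q x in qx
  ... | true  | true  = s≤s (count-mono p q xs h)
  ... | true  | false = ⊥-elim (true≢false (h x px) qx)
  ... | false | true  = ℕ.m≤n⇒m≤1+n (count-mono p q xs h)
  ... | false | false = count-mono p q xs h

  any-filterᵇ⇒ : ∀ (P p : A → Bool) xs → any p (filterᵇ P xs) ≡ true →
                 ∃[ x ] (P x ≡ true × p x ≡ true)
  any-filterᵇ⇒ P p (x ∷ xs) e with P x in Px
  ... | false = any-filterᵇ⇒ P p xs e
  ... | true with ∨-elim (p x) e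
  ...   | inj₁ px   = x , Px , px
  ...   | inj₂ rest = any-filterᵇ⇒ P p xs rest

  any-filterᵇ-intro : ∀ (P p : A → Bool) xs → count (λ x → P x ∧ p x) xs ≢ 0 →
                      any p (filterᵇ P xs) ≡ true
  any-filterᵇ-intro P p []       h = ⊥-elim (h refl)
  any-filterᵇ-intro P p (x ∷ xs) h with P x
  ... | false = any-filterᵇ-intro P p xs h
  ... | true with p x
  ...   | true  = refl
  ...   | false = any-filterᵇ-intro P p xs h

module _ {A B : Set} where

  count-map : ∀ (p : B → Bool) (g : A → B) xs → count p (map g xs) ≡ count (λ x → p (g x)) xs
  count-map p g []       = refl
  count-map p g (x ∷ xs) = cong (indicator (p (g x)) +_) (count-map p g xs)

  count-concatMap : ∀ (p : B → Bool) (h : A → List B) xs →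
                    count p (concatMap h xs) ≡ sumBy (λ x → count p (h x)) xs
  count-concatMap p h []       = refl
  count-concatMap p h (x ∷ xs) =
    trans (count-++ p (h x) _) (cong (count p (h x) +_) (count-concatMap p h xs))

  sumBy-count-swap : ∀ (R : A → B → Bool) xs ys →
    sumBy (λ x → count (R x) ys) xs ≡ sumBy (λ y → count (λ x → R x y) xs) ys
  sumBy-count-swap R []       ys = sym (sumBy-zero ys)
  sumBy-count-swap R (x ∷ xs) ys = begin
    count (R x) ys + sumBy (λ x → count (R x) ys) xs
      ≡⟨ cong₂ _+_ (count≡sumBy (R x) ys) (sumBy-count-swap R xs ys) ⟩
    sumBy (λ y → indicator (R x y)) ys + sumBy (λ y → count (λ x → R x y) xs) ys
      ≡⟨ sym (sumBy-+ _ _ ys) ⟩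
    sumBy (λ y → count (λ x' → R x' y) (x ∷ xs)) ys ∎
    where open ≡-Reasoning

-- Without function extensionality the functions Fin m → Fin k have no decidable
-- equality, so an enumeration lists each element once up to a Boolean equivalence.
record Enumeration (A : Set) : Set where
  field
    elements   : List A
    same       : A → A → Bool
    same-refl  : ∀ a → same a a ≡ true
    same-sym   : ∀ a b → same a b ≡ true → same b a ≡ true
    same-trans : ∀ a b c → same a b ≡ true → same b c ≡ true → same a c ≡ true
    occurs-once : ∀ a → count (same a) elements ≡ 1

open Enumeration public

Respects : ∀ {A} → Enumeration A → (A → Bool) → Set
Respects E P = ∀ a a' → same E a a' ≡ true → P a ≡ P a'

Preserves : ∀ {A B} → Enumeration A → Enumeration B → (A → B) → Set
Preserves EA EB φ = ∀ a a' → same EA a a' ≡ true → same EB (φ a) (φ a') ≡ true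

count-class : ∀ {A} (E : Enumeration A) (P : A → Bool) → Respects E P →
              ∀ a → P a ≡ true → count (λ b → P b ∧ same E a b) (elements E) ≡ 1
count-class E P resp a Pa = trans (count-cong (elements E) only-class) (occurs-once E a)
  where
  only-class : ∀ b → P b ∧ same E a b ≡ same E a b
  only-class b with same E a b in ab
  ... | false = ∧-zeroʳ (P b)
  ... | true  = trans (∧-identityʳ (P b)) (trans (sym (resp a b ab)) Pa)

module _ {A B : Set} (EA : Enumeration A) (EB : Enumeration B)
         (P : A → Bool) (Q : B → Bool) (respP : Respects EA P) (respQ : Respects EB Q)
         (φ : A → B) (ψ : B → A) (presφ : Preserves EA EB φ) (presψ : Preserves EB EA ψ)
         (φ-into : ∀ a → P a ≡ true → Q (φ a) ≡ true)
         (ψ-into : ∀ b → Q b ≡ true → P (ψ b) ≡ true)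
         (ψφ : ∀ a → P a ≡ true → same EA (ψ (φ a)) a ≡ true)
         (φψ : ∀ b → Q b ≡ true → same EB (φ (ψ b)) b ≡ true) where

  private
    matchA : A → B → Bool
    matchA a b = P a ∧ (Q b ∧ same EB (φ a) b)

    matchB : A → B → Bool
    matchB a b = Q b ∧ (P a ∧ same EA (ψ b) a)

    match-sym : ∀ a b → matchA a b ≡ matchB a b
    match-sym a b = bool-ext to from
      where
      to : matchA a b ≡ true → matchB a b ≡ true
      to e = ∧-intro Qb (∧-intro Pa (same-trans EA _ _ _ (presψ _ _ (same-sym EB _ _ φa≈b)) (ψφ a Pa)))
        where
        Pa = ∧-elimˡ (P a) e
        Qb = ∧-elimˡ (Q b) (∧-elimʳ (P a) e)
        φa≈b = ∧-elimʳ (Q b) (∧-elimʳ (P a) e)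
      from : matchB a b ≡ true → matchA a b ≡ true
      from e = ∧-intro Pa (∧-intro Qb (same-trans EB _ _ _ (presφ _ _ (same-sym EA _ _ ψb≈a)) (φψ b Qb)))
        where
        Qb = ∧-elimˡ (Q b) e
        Pa = ∧-elimˡ (P a) (∧-elimʳ (Q b) e)
        ψb≈a = ∧-elimʳ (P a) (∧-elimʳ (Q b) e)

    matchesA : ∀ a → count (matchA a) (elements EB) ≡ indicator (P a)
    matchesA a with P a in Pa
    ... | true  = count-class EB Q respQ (φ a) (φ-into a Pa)
    ... | false = count-none _ (elements EB) (λ _ → refl)

    matchesB : ∀ b → count (λ a → matchB a b) (elements EA) ≡ indicator (Q b)
    matchesB b with Q b in Qb
    ... | true  = count-class EA P respP (ψ b) (ψ-into b Qb)
    ... | false = count-none _ (elements EA) (λ _ → refl)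

  -- Double counting of the pairs (a , b) with φ a ≈ b, equivalently ψ b ≈ a.
  count-bijection : count P (elements EA) ≡ count Q (elements EB)
  count-bijection = begin
    count P LA                                        ≡⟨ count≡sumBy P LA ⟩
    sumBy (λ a → indicator (P a)) LA                  ≡⟨ sumBy-cong LA (sym ∘ matchesA) ⟩
    sumBy (λ a → count (matchA a) LB) LA
      ≡⟨ sumBy-cong LA (λ a → count-cong LB (match-sym a)) ⟩
    sumBy (λ a → count (λ b → matchB a b) LB) LA
      ≡⟨ sumBy-count-swap matchB LA LB ⟩
    sumBy (λ b → count (λ a → matchB a b) LA) LB
      ≡⟨ sumBy-cong LB matchesB ⟩
    sumBy (λ b → indicator (Q b)) LB                  ≡⟨ sym (count≡sumBy Q LB) ⟩
    count Q LB ∎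
    where
    open ≡-Reasoning
    LA = elements EA
    LB = elements EB

count-product : ∀ {C D E : Set} (mk : C → D → E) (S : E → Bool) (Q : C → Bool) (R : D → Bool)
  (cs : List C) (ds : List D) → (∀ c d → S (mk c d) ≡ Q c ∧ R d) →
  count S (concatMap (λ c → map (mk c) ds) cs) ≡ count Q cs * count R ds
count-product mk S Q R cs ds split = begin
  count S (concatMap (λ c → map (mk c) ds) cs)   ≡⟨ count-concatMap S _ cs ⟩
  sumBy (λ c → count S (map (mk c) ds)) cs       ≡⟨ sumBy-cong cs row ⟩
  sumBy (λ c → indicator (Q c) * count R ds) cs  ≡⟨ sumBy-*ʳ _ _ cs ⟩
  sumBy (λ c → indicator (Q c)) cs * count R ds  ≡⟨ cong (_* count R ds) (sym (count≡sumBy Q cs)) ⟩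
  count Q cs * count R ds ∎
  where
  open ≡-Reasoning
  row : ∀ c → count S (map (mk c) ds) ≡ indicator (Q c) * count R ds
  row c = trans (count-map S (mk c) ds) (trans (count-cong ds (split c)) (count-∧ˡ (Q c) R ds))

allIdx-once : ∀ k (a : Fin k) → count (a ==ᶠ_) (allIdx k) ≡ 1
allIdx-once (suc k) zero = cong suc (trans (count-map _ suc (allIdx k))
  (count-none _ (allIdx k) (λ x → ≢⇒==ᶠ-false {i = zero} {suc x} λ ())))
allIdx-once (suc k) (suc a) = begin
  indicator (suc a ==ᶠ zero) + count (suc a ==ᶠ_) (map suc (allIdx k))
    ≡⟨ cong₂ _+_ (cong indicator (≢⇒==ᶠ-false {i = suc a} {zero} λ ())) (count-map _ suc (allIdx k)) ⟩
  count (λ x → suc a ==ᶠ suc x) (allIdx k)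
    ≡⟨ count-cong (allIdx k) (λ x → bool-ext (≡⇒==ᶠ ∘ Fin.suc-injective ∘ ==ᶠ⇒≡)
                                             (≡⇒==ᶠ ∘ cong suc ∘ ==ᶠ⇒≡)) ⟩
  count (a ==ᶠ_) (allIdx k) ≡⟨ allIdx-once k a ⟩
  1 ∎
  where open ≡-Reasoning

length-allIdx : ∀ k → count (λ (_ : Fin k) → true) (allIdx k) ≡ k
length-allIdx zero    = refl
length-allIdx (suc k) = cong suc (trans (count-map _ suc (allIdx k)) (length-allIdx k))

finEnum : ∀ k → Enumeration (Fin k)
finEnum k = record
  { elements    = allIdx k
  ; same        = _==ᶠ_
  ; same-refl   = ==ᶠ-refl
  ; same-sym    = λ _ _ e → ≡⇒==ᶠ (sym (==ᶠ⇒≡ e))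
  ; same-trans  = λ _ _ _ e e′ → ≡⇒==ᶠ (trans (==ᶠ⇒≡ e) (==ᶠ⇒≡ e′))
  ; occurs-once = allIdx-once k
  }

pairs : ∀ {A B : Set} → List A → List B → List (A × B)
pairs as bs = concatMap (λ a → map (a ,_) bs) as

count-pairs : ∀ {A B : Set} (P : A → Bool) (Q : B → Bool) as bs →
  count (λ ab → P (proj₁ ab) ∧ Q (proj₂ ab)) (pairs as bs) ≡ count P as * count Q bs
count-pairs P Q as bs = count-product _,_ _ P Q as bs (λ _ _ → refl)

×-enum : ∀ {A B} → Enumeration A → Enumeration B → Enumeration (A × B)
×-enum EA EB = record
  { elements    = pairs (elements EA) (elements EB)
  ; same        = λ x y → same EA (proj₁ x) (proj₁ y) ∧ same EB (proj₂ x) (proj₂ y)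
  ; same-refl   = λ x → ∧-intro (same-refl EA _) (same-refl EB _)
  ; same-sym    = λ x y e → ∧-intro (same-sym EA _ _ (∧-elimˡ (same EA _ _) e))
                                    (same-sym EB _ _ (∧-elimʳ (same EA _ _) e))
  ; same-trans  = λ x y z e e′ →
      ∧-intro (same-trans EA _ _ _ (∧-elimˡ (same EA _ _) e) (∧-elimˡ (same EA _ _) e′))
              (same-trans EB _ _ _ (∧-elimʳ (same EA _ _) e) (∧-elimʳ (same EA _ _) e′))
  ; occurs-once = λ x → trans (count-pairs (same EA (proj₁ x)) (same EB (proj₂ x)) (elements EA) (elements EB))
                              (cong₂ _*_ (occurs-once EA (proj₁ x)) (occurs-once EB (proj₂ x)))
  }

tuples : ∀ m {C : Set} → List C → List (Fin m → C)
tuples zero    cs = (λ ()) ∷ []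
tuples (suc m) cs = concatMap (λ c → map (c ∷ᶠ_) (tuples m cs)) cs

count-tuples : ∀ m {C : Set} (Q : Fin m → C → Bool) cs c → (∀ i → count (Q i) cs ≡ c) →
  count (λ f → allFin m (λ i → Q i (f i))) (tuples m cs) ≡ c ^ m
count-tuples zero    Q cs c h = refl
count-tuples (suc m) Q cs c h =
  trans (count-product _∷ᶠ_ _ (Q zero) (λ g → allFin m (λ i → Q (suc i) (g i))) cs _ (λ _ _ → refl))
        (cong₂ _*_ (h zero) (count-tuples m (Q ∘ suc) cs c (h ∘ suc)))

count-allFuns : ∀ m k (Q : Fin m → Fin k → Bool) c → (∀ i → count (Q i) (allIdx k) ≡ c) →
  count (λ f → allFin m (λ i → Q i (f i))) (allFuns m k) ≡ c ^ m
count-allFuns zero    k Q c h = refl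
count-allFuns (suc m) k Q c h =
  trans (count-product _ _ (Q zero) (λ g → allFin m (λ i → Q (suc i) (g i))) (allIdx k) _ (λ _ _ → refl))
        (cong₂ _*_ (h zero) (count-allFuns m k (Q ∘ suc) c (h ∘ suc)))

pointwiseEnum : ∀ m {C} (EC : Enumeration C) (fs : List (Fin m → C)) →
  (∀ f → count (λ g → allFin m (λ i → same EC (f i) (g i))) fs ≡ 1) → Enumeration (Fin m → C)
pointwiseEnum m EC fs once = record
  { elements    = fs
  ; same        = λ f g → allFin m (λ i → same EC (f i) (g i))
  ; same-refl   = λ f → allFin-intro m (λ i → same-refl EC _)
  ; same-sym    = λ f g e → allFin-intro m (λ i → same-sym EC _ _ (allFin⇒ m e i))
  ; same-trans  = λ f g h e e′ → allFin-intro m (λ i → same-trans EC _ _ _ (allFin⇒ m e i) (allFin⇒ m e′ i))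
  ; occurs-once = once
  }

tupleEnum : ∀ m {C} → Enumeration C → Enumeration (Fin m → C)
tupleEnum m EC = pointwiseEnum m EC (tuples m (elements EC)) λ f →
  trans (count-tuples m (λ i → same EC (f i)) (elements EC) 1 (λ i → occurs-once EC (f i))) (ℕ.^-zeroˡ m)

allFunsEnum : ∀ m k → Enumeration (Fin m → Fin k)
allFunsEnum m k = pointwiseEnum m (finEnum k) (allFuns m k) λ f →
  trans (count-allFuns m k (λ i → f i ==ᶠ_) 1 (λ i → allIdx-once k (f i))) (ℕ.^-zeroˡ m)

same-allFuns⇒ : ∀ {m k} (f g : Fin m → Fin k) → same (allFunsEnum m k) f g ≡ true → ∀ i → f i ≡ g i
same-allFuns⇒ {m} _ _ e i = ==ᶠ⇒≡ (allFin⇒ m e i)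

pointwise⇒same-allFuns : ∀ {m k} (f g : Fin m → Fin k) → (∀ i → f i ≡ g i) →
                         same (allFunsEnum m k) f g ≡ true
pointwise⇒same-allFuns {m} _ _ h = allFin-intro m (≡⇒==ᶠ ∘ h)

length-allFuns : ∀ m k → count (λ _ → true) (allFuns m k) ≡ k ^ m
length-allFuns m k = trans (count-cong (allFuns m k) (λ _ → sym (allFin-intro m {λ _ → true} (λ _ → refl))))
                           (count-allFuns m k (λ _ _ → true) k (λ _ → length-allIdx k))

-- Injective and hyperoctahedral maps

implies⇒ : ∀ {n} {x y : Fin n} c → not (x ==ᶠ y) ∨ c ≡ true → x ≡ y → c ≡ true
implies⇒ c e x≡y = subst (λ b → not b ∨ c ≡ true) (≡⇒==ᶠ x≡y) e

implies-intro : ∀ {n} {x y : Fin n} c → (x ≡ y → c ≡ true) → not (x ==ᶠ y) ∨ c ≡ true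
implies-intro {x = x} {y} c h with x ==ᶠ y in e
... | false = refl
... | true  = h (==ᶠ⇒≡ e)

isInjectiveᵇ : ∀ {m k} → (Fin m → Fin k) → Bool
isInjectiveᵇ {m} f = allFin m (λ u → allFin m (λ v → not (f u ==ᶠ f v) ∨ (u ==ᶠ v)))

isInjectiveᵇ⇒ : ∀ {m k} (f : Fin m → Fin k) → isInjectiveᵇ f ≡ true → Injective _≡_ _≡_ f
isInjectiveᵇ⇒ {m} f e {u} {v} = ==ᶠ⇒≡ ∘ implies⇒ _ (allFin⇒ m (allFin⇒ m e u) v)

injective⇒isInjectiveᵇ : ∀ {m k} (f : Fin m → Fin k) → Injective _≡_ _≡_ f → isInjectiveᵇ f ≡ true
injective⇒isInjectiveᵇ {m} f inj =
  allFin-intro m (λ u → allFin-intro m (λ v → implies-intro _ (≡⇒==ᶠ ∘ inj)))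

isInjectiveᵇ-respects : ∀ {m k} → Respects (allFunsEnum m k) isInjectiveᵇ
isInjectiveᵇ-respects {m} f f′ e = allFin-cong m (λ u → allFin-cong m (λ v →
  cong (λ b → not b ∨ (u ==ᶠ v)) (cong₂ _==ᶠ_ (same-allFuns⇒ f f′ e u) (same-allFuns⇒ f f′ e v))))

-- punchOut made total: the value of unpunch a a is arbitrary.
unpunch : ∀ {k} → Fin (suc (suc k)) → Fin (suc (suc k)) → Fin (suc k)
unpunch zero    zero    = zero
unpunch zero    (suc b) = b
unpunch (suc a) zero    = zero
unpunch {zero}  (suc a) (suc b) = zero
unpunch {suc k} (suc a) (suc b) = suc (unpunch a b)

unpunch-punchIn : ∀ {k} (a : Fin (suc (suc k))) (j : Fin (suc k)) → unpunch a (punchIn a j) ≡ j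
unpunch-punchIn zero    j       = refl
unpunch-punchIn (suc a) zero    = refl
unpunch-punchIn {suc k} (suc a) (suc j) = cong suc (unpunch-punchIn a j)

punchIn-unpunch : ∀ {k} (a b : Fin (suc (suc k))) → a ≢ b → punchIn a (unpunch a b) ≡ b
punchIn-unpunch zero    zero    a≢b = ⊥-elim (a≢b refl)
punchIn-unpunch zero    (suc b) _   = refl
punchIn-unpunch (suc a) zero    _   = refl
punchIn-unpunch {zero}  (suc zero) (suc zero) a≢b = ⊥-elim (a≢b refl)
punchIn-unpunch {suc k} (suc a) (suc b) a≢b = cong suc (punchIn-unpunch a b (a≢b ∘ cong suc))

-- An injection f of Fin (2 + M) corresponds to the pair (f 0, the injection of
-- Fin (1 + M) obtained by punching f 0 out of the remaining values).
count-injective : ∀ m → count isInjectiveᵇ (allFuns m m) ≡ m !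
count-injective zero          = refl
count-injective (suc zero)    = refl
count-injective (suc (suc M)) = trans
  (count-bijection E E′ isInjectiveᵇ (λ ag → true ∧ isInjectiveᵇ (proj₂ ag))
    isInjectiveᵇ-respects
    (λ x y e → isInjectiveᵇ-respects (proj₂ x) (proj₂ y) (∧-elimʳ (proj₁ x ==ᶠ proj₁ y) e))
    split join split-preserves join-preserves split-injective join-injective join-split split-join)
  (trans (count-pairs (λ _ → true) isInjectiveᵇ (allIdx S) (allFuns (suc M) (suc M)))
    (cong₂ _*_ (length-allIdx S) (count-injective (suc M))))
  where
  S = suc (suc M)
  E = allFunsEnum S S
  E′ = ×-enum (finEnum S) (allFunsEnum (suc M) (suc M))

  split : (Fin S → Fin S) → Fin S × (Fin (suc M) → Fin (suc M))
  split f = f zero , (λ i → unpunch (f zero) (f (suc i)))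

  join : Fin S × (Fin (suc M) → Fin (suc M)) → (Fin S → Fin S)
  join (a , g) = a ∷ᶠ (punchIn a ∘ g)

  zero≢suc : ∀ {i : Fin (suc M)} → zero ≢ suc i
  zero≢suc ()

  split-preserves : Preserves E E′ split
  split-preserves f f′ e = ∧-intro (≡⇒==ᶠ (same-allFuns⇒ f f′ e zero))
    (pointwise⇒same-allFuns _ _ (λ i →
      cong₂ unpunch (same-allFuns⇒ f f′ e zero) (same-allFuns⇒ f f′ e (suc i))))

  join-preserves : Preserves E′ E join
  join-preserves (a , g) (a′ , g′) e = pointwise⇒same-allFuns (join (a , g)) (join (a′ , g′)) λ
    { zero    → a≡a′
    ; (suc i) → cong₂ punchIn a≡a′ (same-allFuns⇒ g g′ (∧-elimʳ (a ==ᶠ a′) e) i) }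
    where a≡a′ = ==ᶠ⇒≡ (∧-elimˡ (a ==ᶠ a′) e)

  split-injective : ∀ f → isInjectiveᵇ f ≡ true → true ∧ isInjectiveᵇ (proj₂ (split f)) ≡ true
  split-injective f e = injective⇒isInjectiveᵇ _ λ {u} {v} eq → Fin.suc-injective (inj (begin
      f (suc u)                                       ≡⟨ sym (punchIn-unpunch (f zero) _ (zero≢suc ∘ inj)) ⟩
      punchIn (f zero) (unpunch (f zero) (f (suc u))) ≡⟨ cong (punchIn (f zero)) eq ⟩
      punchIn (f zero) (unpunch (f zero) (f (suc v))) ≡⟨ punchIn-unpunch (f zero) _ (zero≢suc ∘ inj) ⟩
      f (suc v)                                       ∎))
    where
    inj = isInjectiveᵇ⇒ f e
    open ≡-Reasoning

  join-injective : ∀ ag → true ∧ isInjectiveᵇ (proj₂ ag) ≡ true → isInjectiveᵇ (join ag) ≡ true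
  join-injective (a , g) e = injective⇒isInjectiveᵇ _ inj
    where
    inj : Injective _≡_ _≡_ (join (a , g))
    inj {zero}  {zero}  _  = refl
    inj {zero}  {suc v} eq = ⊥-elim (Fin.punchInᵢ≢i a (g v) (sym eq))
    inj {suc u} {zero}  eq = ⊥-elim (Fin.punchInᵢ≢i a (g u) eq)
    inj {suc u} {suc v} eq = cong suc (isInjectiveᵇ⇒ g e (Fin.punchIn-injective a (g u) (g v) eq))

  join-split : ∀ f → isInjectiveᵇ f ≡ true → same E (join (split f)) f ≡ true
  join-split f e = pointwise⇒same-allFuns (join (split f)) f λ
    { zero    → refl
    ; (suc i) → punchIn-unpunch (f zero) (f (suc i)) (zero≢suc ∘ isInjectiveᵇ⇒ f e) }

  split-join : ∀ ag → true ∧ isInjectiveᵇ (proj₂ ag) ≡ true → same E′ (split (join ag)) ag ≡ true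
  split-join (a , g) _ = ∧-intro (==ᶠ-refl a) (pointwise⇒same-allFuns _ g (unpunch-punchIn a ∘ g))

other : Fin 2 → Fin 2
other zero       = suc zero
other (suc zero) = zero

other-≢ : ∀ b → other b ≢ b
other-≢ zero       ()
other-≢ (suc zero) ()

Fin2-≢-≢⇒≡ : ∀ {x y z : Fin 2} → x ≢ y → x ≢ z → y ≡ z
Fin2-≢-≢⇒≡ {zero}     {zero}     x≢y _   = ⊥-elim (x≢y refl)
Fin2-≢-≢⇒≡ {zero}     {suc zero} {zero}     _ x≢z = ⊥-elim (x≢z refl)
Fin2-≢-≢⇒≡ {zero}     {suc zero} {suc zero} _ _   = refl
Fin2-≢-≢⇒≡ {suc zero} {zero}     {zero}     _ _   = refl
Fin2-≢-≢⇒≡ {suc zero} {zero}     {suc zero} _ x≢z = ⊥-elim (x≢z refl)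
Fin2-≢-≢⇒≡ {suc zero} {suc zero} x≢y _   = ⊥-elim (x≢y refl)

infixl 6 _+₂_
_+₂_ : Fin 2 → Fin 2 → Fin 2
zero     +₂ e = e
suc zero +₂ e = other e

+₂-cancelʳ : ∀ b b′ e → b +₂ e ≡ b′ +₂ e → b ≡ b′
+₂-cancelʳ zero       zero       e          _  = refl
+₂-cancelʳ zero       (suc zero) zero       ()
+₂-cancelʳ zero       (suc zero) (suc zero) ()
+₂-cancelʳ (suc zero) zero       zero       ()
+₂-cancelʳ (suc zero) zero       (suc zero) ()
+₂-cancelʳ (suc zero) (suc zero) e          _  = refl

+₂-self : ∀ b e → b +₂ (b +₂ e) ≡ e
+₂-self zero       e          = refl
+₂-self (suc zero) zero       = refl
+₂-self (suc zero) (suc zero) = refl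

other-+₂-self : ∀ b e → other b +₂ (b +₂ e) ≡ other e
other-+₂-self zero       e          = refl
other-+₂-self (suc zero) zero       = refl
other-+₂-self (suc zero) (suc zero) = refl

transpose-injective : ∀ {t} (a b : Fin t) → Injective _≡_ _≡_ (PC.transpose a b)
transpose-injective a b {x} {y} eq = begin
  x                                            ≡⟨ sym (PC.transpose-inverse b a) ⟩
  PC.transpose b a (PC.transpose a b x)        ≡⟨ cong (PC.transpose b a) eq ⟩
  PC.transpose b a (PC.transpose a b y)        ≡⟨ PC.transpose-inverse b a ⟩
  y                                            ∎
  where open ≡-Reasoning

transpose-source : ∀ {t} (a b : Fin t) → PC.transpose a b a ≡ b
transpose-source a b with a Fin.≟ a
... | yes _  = refl
... | no a≢a = ⊥-elim (a≢a refl)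

-- The 2t triangle vertices at an original vertex form t blocks (triangles) of two
-- sides, decoded with remQuot exactly as in M3.
module Blocks (t : ℕ) where

  block : Fin (t * 2) → Fin t
  block j = proj₁ (remQuot {t} 2 j)

  side : Fin (t * 2) → Fin 2
  side j = proj₂ (remQuot {t} 2 j)

  slot : Fin t → Fin 2 → Fin (t * 2)
  slot = combine

  block-slot : ∀ c b → block (slot c b) ≡ c
  block-slot c b = cong proj₁ (Fin.remQuot-combine c b)

  side-slot : ∀ c b → side (slot c b) ≡ b
  side-slot c b = cong proj₂ (Fin.remQuot-combine c b)

  slot-block-side : ∀ j → slot (block j) (side j) ≡ j
  slot-block-side = Fin.combine-remQuot {t} 2

  block-side-injective : ∀ {j j′} → block j ≡ block j′ → side j ≡ side j′ → j ≡ j′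
  block-side-injective {j} {j′} c≡c′ b≡b′ =
    trans (sym (slot-block-side j)) (trans (cong₂ slot c≡c′ b≡b′) (slot-block-side j′))

  partner : Fin (t * 2) → Fin (t * 2)
  partner j = slot (block j) (other (side j))

  block-partner : ∀ j → block (partner j) ≡ block j
  block-partner j = block-slot (block j) _

  partner-≢ : ∀ j → partner j ≢ j
  partner-≢ j eq = other-≢ (side j) (trans (sym (side-slot (block j) _)) (cong side eq))

  block-third : ∀ {x y z} → block x ≡ block y → block x ≡ block z → x ≢ y → x ≢ z → y ≡ z
  block-third xy xz x≢y x≢z = block-side-injective (trans (sym xy) xz)
    (Fin2-≢-≢⇒≡ (x≢y ∘ block-side-injective xy) (x≢z ∘ block-side-injective xz))

  ≡partner : ∀ {j k} → block j ≡ block k → j ≢ k → k ≡ partner j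
  ≡partner {j} jk j≢k =
    block-third jk (sym (block-partner j)) j≢k (λ j≡p → partner-≢ j (sym j≡p))

  PreservesBlocks : (Fin (t * 2) → Fin (t * 2)) → Set
  PreservesBlocks π = ∀ j j′ → block j ≡ block j′ → block (π j) ≡ block (π j′)

  preservesBlocksᵇ : (Fin (t * 2) → Fin (t * 2)) → Bool
  preservesBlocksᵇ π = allFin (t * 2) (λ j → allFin (t * 2) (λ j′ →
    not (block j ==ᶠ block j′) ∨ (block (π j) ==ᶠ block (π j′))))

  isHyperoctahedralᵇ : (Fin (t * 2) → Fin (t * 2)) → Bool
  isHyperoctahedralᵇ π = isInjectiveᵇ π ∧ preservesBlocksᵇ π

  module _ {π : Fin (t * 2) → Fin (t * 2)} (h : isHyperoctahedralᵇ π ≡ true) where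

    hyperoctahedral⇒injective : Injective _≡_ _≡_ π
    hyperoctahedral⇒injective = isInjectiveᵇ⇒ π (∧-elimˡ (isInjectiveᵇ π) h)

    hyperoctahedral⇒preservesBlocks : PreservesBlocks π
    hyperoctahedral⇒preservesBlocks j j′ =
      ==ᶠ⇒≡ ∘ implies⇒ _ (allFin⇒ (t * 2) (allFin⇒ (t * 2) (∧-elimʳ (isInjectiveᵇ π) h) j) j′)

    hyperoctahedral-reflectsBlocks : ∀ j j′ → block (π j) ≡ block (π j′) → block j ≡ block j′
    hyperoctahedral-reflectsBlocks j j′ πj~πj′ with block j Fin.≟ block j′
    ... | yes j~j′ = j~j′
    ... | no  j≁j′ = ⊥-elim (j≁j′ (trans (sym (block-partner j)) (cong block (inj (block-third
      (sym (hyperoctahedral⇒preservesBlocks (partner j) j (block-partner j))) πj~πj′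
      (partner-≢ j ∘ sym ∘ inj) (j≁j′ ∘ cong block ∘ inj))))))
      where inj = hyperoctahedral⇒injective

  hyperoctahedral-intro : ∀ π → Injective _≡_ _≡_ π → PreservesBlocks π → isHyperoctahedralᵇ π ≡ true
  hyperoctahedral-intro π inj pres = ∧-intro (injective⇒isInjectiveᵇ π inj)
    (allFin-intro (t * 2) (λ j → allFin-intro (t * 2) (λ j′ → implies-intro _ (≡⇒==ᶠ ∘ pres j j′))))

  isHyperoctahedralᵇ-respects : Respects (allFunsEnum (t * 2) (t * 2)) isHyperoctahedralᵇ
  isHyperoctahedralᵇ-respects f f′ e = cong₂ _∧_ (isInjectiveᵇ-respects f f′ e)
    (allFin-cong (t * 2) (λ j → allFin-cong (t * 2) (λ j′ → cong (not (block j ==ᶠ block j′) ∨_)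
      (cong₂ (λ x y → block x ==ᶠ block y) (same-allFuns⇒ f f′ e j) (same-allFuns⇒ f f′ e j′)))))

  signedPerm : (Fin t → Fin t) → (Fin t → Fin 2) → Fin (t * 2) → Fin (t * 2)
  signedPerm τ ε j = slot (τ (block j)) (side j +₂ ε (block j))

  signedPerm-slot : ∀ τ ε c b → signedPerm τ ε (slot c b) ≡ slot (τ c) (b +₂ ε c)
  signedPerm-slot τ ε c b = cong₂ (λ x y → slot (τ x) (y +₂ ε x)) (block-slot c b) (side-slot c b)

  signedPerm-hyperoctahedral : ∀ τ ε → Injective _≡_ _≡_ τ → isHyperoctahedralᵇ (signedPerm τ ε) ≡ true
  signedPerm-hyperoctahedral τ ε τ-inj = hyperoctahedral-intro _ inj pres
    where
    inj : Injective _≡_ _≡_ (signedPerm τ ε)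
    inj {j} {j′} eq = block-side-injective c≡c′
      (+₂-cancelʳ _ _ _ (trans (proj₂ parts) (cong (λ c → side j′ +₂ ε c) (sym c≡c′))))
      where
      parts = Fin.combine-injective (τ (block j)) _ (τ (block j′)) _ eq
      c≡c′ = τ-inj (proj₁ parts)
    pres : PreservesBlocks (signedPerm τ ε)
    pres j j′ c≡c′ = trans (block-slot _ _) (trans (cong τ c≡c′) (sym (block-slot _ _)))

  -- Each block is mapped onto a block, and the image of side 1 is then forced.
  hyperoctahedral-slot : ∀ {π} → isHyperoctahedralᵇ π ≡ true → ∀ c b →
    π (slot c b) ≡ slot (block (π (slot c zero))) (b +₂ side (π (slot c zero)))
  hyperoctahedral-slot h c zero = sym (slot-block-side _)
  hyperoctahedral-slot {π} h c (suc zero) =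
    trans (sym (slot-block-side y)) (cong₂ slot (sym x~y) (Fin2-≢-≢⇒≡ sides-differ (other-≢ (side x) ∘ sym)))
    where
    x = π (slot c zero)
    y = π (slot c (suc zero))
    x~y : block x ≡ block y
    x~y = hyperoctahedral⇒preservesBlocks h _ _ (trans (block-slot c _) (sym (block-slot c _)))
    sides-differ : side x ≢ side y
    sides-differ sx≡sy with trans (sym (side-slot c zero)) (trans (cong side
      (hyperoctahedral⇒injective h (block-side-injective x~y sx≡sy))) (side-slot c (suc zero)))
    ... | ()

  -- A hyperoctahedral map is a signed permutation: a permutation τ of the blocks
  -- together with a flip ε of the sides within each block.
  count-hyperoctahedral : count isHyperoctahedralᵇ (allFuns (t * 2) (t * 2)) ≡ t ! * 2 ^ t
  count-hyperoctahedral = trans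
    (count-bijection E E′ isHyperoctahedralᵇ (λ τε → isInjectiveᵇ (proj₁ τε) ∧ true)
      isHyperoctahedralᵇ-respects
      (λ x y e → cong (_∧ true)
        (isInjectiveᵇ-respects (proj₁ x) (proj₁ y) (∧-elimˡ (same (allFunsEnum t t) _ _) e)))
      decompose compose decompose-preserves compose-preserves
      decompose-injective compose-hyperoctahedral compose-decompose decompose-compose)
    (trans (count-pairs isInjectiveᵇ (λ _ → true) (allFuns t t) (allFuns t 2))
      (cong₂ _*_ (count-injective t) (length-allFuns t 2)))
    where
    E = allFunsEnum (t * 2) (t * 2)
    E′ = ×-enum (allFunsEnum t t) (allFunsEnum t 2)

    decompose : (Fin (t * 2) → Fin (t * 2)) → (Fin t → Fin t) × (Fin t → Fin 2)
    decompose π = (λ c → block (π (slot c zero))) , (λ c → side (π (slot c zero)))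

    compose : (Fin t → Fin t) × (Fin t → Fin 2) → (Fin (t * 2) → Fin (t * 2))
    compose (τ , ε) = signedPerm τ ε

    decompose-preserves : Preserves E E′ decompose
    decompose-preserves f f′ e = ∧-intro
      (pointwise⇒same-allFuns _ _ (λ c → cong block (same-allFuns⇒ f f′ e (slot c zero))))
      (pointwise⇒same-allFuns _ _ (λ c → cong side (same-allFuns⇒ f f′ e (slot c zero))))

    compose-preserves : Preserves E′ E compose
    compose-preserves (τ , ε) (τ′ , ε′) e = pointwise⇒same-allFuns _ _ λ j →
      cong₂ slot (same-allFuns⇒ τ τ′ τ≈τ′ (block j))
                 (cong (side j +₂_) (same-allFuns⇒ ε ε′ ε≈ε′ (block j)))
      where
      τ≈τ′ = ∧-elimˡ (same (allFunsEnum t t) τ τ′) e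
      ε≈ε′ = ∧-elimʳ (same (allFunsEnum t t) τ τ′) e

    decompose-injective : ∀ π → isHyperoctahedralᵇ π ≡ true →
                          isInjectiveᵇ (proj₁ (decompose π)) ∧ true ≡ true
    decompose-injective π h = ∧-intro (injective⇒isInjectiveᵇ _ λ {c} {c′} eq →
      trans (sym (block-slot c zero)) (trans (hyperoctahedral-reflectsBlocks h _ _ eq) (block-slot c′ zero))) refl

    compose-hyperoctahedral : ∀ τε → isInjectiveᵇ (proj₁ τε) ∧ true ≡ true →
                              isHyperoctahedralᵇ (compose τε) ≡ true
    compose-hyperoctahedral (τ , ε) e =
      signedPerm-hyperoctahedral τ ε (isInjectiveᵇ⇒ τ (∧-elimˡ (isInjectiveᵇ τ) e))

    compose-decompose : ∀ π → isHyperoctahedralᵇ π ≡ true → same E (compose (decompose π)) π ≡ true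
    compose-decompose π h = pointwise⇒same-allFuns _ _ λ j → begin
      signedPerm τ ε j                                 ≡⟨ cong (signedPerm τ ε) (sym (slot-block-side j)) ⟩
      signedPerm τ ε (slot (block j) (side j))         ≡⟨ signedPerm-slot τ ε (block j) (side j) ⟩
      slot (block (π (slot (block j) zero))) (side j +₂ side (π (slot (block j) zero)))
                                                       ≡⟨ sym (hyperoctahedral-slot h (block j) (side j)) ⟩
      π (slot (block j) (side j))                      ≡⟨ cong π (slot-block-side j) ⟩
      π j                                              ∎
      where
      open ≡-Reasoning
      τ = proj₁ (decompose π)
      ε = proj₂ (decompose π)

    decompose-compose : ∀ τε → isInjectiveᵇ (proj₁ τε) ∧ true ≡ true →
                        same E′ (decompose (compose τε)) τε ≡ true
    decompose-compose (τ , ε) _ = ∧-intro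
      (pointwise⇒same-allFuns _ τ (λ c → trans (cong block (signedPerm-slot τ ε c zero)) (block-slot _ _)))
      (pointwise⇒same-allFuns _ ε (λ c → trans (cong side (signedPerm-slot τ ε c zero)) (side-slot _ _)))

  transport : Fin (t * 2) → Fin (t * 2) → Fin (t * 2) → Fin (t * 2)
  transport j k = signedPerm (PC.transpose (block j) (block k)) (λ _ → side j +₂ side k)

  transport-hyperoctahedral : ∀ j k → isHyperoctahedralᵇ (transport j k) ≡ true
  transport-hyperoctahedral j k = signedPerm-hyperoctahedral _ _ (transpose-injective (block j) (block k))

  transport-slot : ∀ j k c b →
    transport j k (slot c b) ≡ slot (PC.transpose (block j) (block k) c) (b +₂ (side j +₂ side k))
  transport-slot j k = signedPerm-slot (PC.transpose (block j) (block k)) (λ _ → side j +₂ side k)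

  transport-source : ∀ j k → transport j k j ≡ k
  transport-source j k = begin
    transport j k j                              ≡⟨ cong (transport j k) (sym (slot-block-side j)) ⟩
    transport j k (slot (block j) (side j))      ≡⟨ transport-slot j k (block j) (side j) ⟩
    slot (PC.transpose (block j) (block k) (block j)) (side j +₂ (side j +₂ side k))
      ≡⟨ cong₂ slot (transpose-source (block j) (block k)) (+₂-self (side j) (side k)) ⟩
    slot (block k) (side k)                      ≡⟨ slot-block-side k ⟩
    k                                            ∎
    where open ≡-Reasoning

  transport-partner : ∀ j k → transport j k (partner j) ≡ partner k
  transport-partner j k = trans (transport-slot j k (block j) (other (side j)))
    (cong₂ slot (transpose-source (block j) (block k)) (other-+₂-self (side j) (side k)))

-- Automorphisms and orbits

record IsAutomorphism {m} (H : Adj m) (f : Fin m → Fin m) : Set where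
  field
    preserves-adj : ∀ u v → H (f u) (f v) ≡ H u v
    injective     : Injective _≡_ _≡_ f

open IsAutomorphism public

module _ {m} (H : Adj m) where

  isAut⇒IsAutomorphism : ∀ f → isAut H f ≡ true → IsAutomorphism H f
  isAut⇒IsAutomorphism f e = record
    { preserves-adj = λ u v → ==ᵇ⇒≡ (∧-elimˡ _ (entry u v))
    ; injective     = λ {u} {v} → ==ᶠ⇒≡ ∘ implies⇒ _ (∧-elimʳ _ (entry u v))
    }
    where
    entry : ∀ u v → (H (f u) (f v) ==ᵇ H u v) ∧ (not (f u ==ᶠ f v) ∨ (u ==ᶠ v)) ≡ true
    entry u v = allFin⇒ m (allFin⇒ m e u) v

  IsAutomorphism⇒isAut : ∀ f → IsAutomorphism H f → isAut H f ≡ true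
  IsAutomorphism⇒isAut f aut = allFin-intro m (λ u → allFin-intro m (λ v →
    ∧-intro (≡⇒==ᵇ (preserves-adj aut u v)) (implies-intro _ (≡⇒==ᶠ ∘ injective aut))))

  isAut-respects : Respects (allFunsEnum m m) (isAut H)
  isAut-respects f f′ e = allFin-cong m (λ u → allFin-cong m (λ v →
    cong₂ (λ a b → (H a b ==ᵇ H u v) ∧ (not (a ==ᶠ b) ∨ (u ==ᶠ v)))
          (same-allFuns⇒ f f′ e u) (same-allFuns⇒ f f′ e v)))

  id-automorphism : IsAutomorphism H id
  id-automorphism = record { preserves-adj = λ _ _ → refl ; injective = id }

injective⇒surjective : ∀ {m} (f : Fin m → Fin m) → Injective _≡_ _≡_ f → ∀ y → ∃[ x ] f x ≡ y
injective⇒surjective {suc m} f inj y with Fin.any? (λ x → f x Fin.≟ y)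
... | yes hit = hit
... | no miss with Fin.pigeonhole (ℕ.n<1+n m) (λ x → punchOut {i = y} {j = f x} (miss ∘ (x ,_) ∘ sym))
...   | i , j , i<j , eq =
  ⊥-elim (Fin.<⇒≢ i<j (inj (Fin.punchOut-injective (miss ∘ (i ,_) ∘ sym) (miss ∘ (j ,_) ∘ sym) eq)))

module _ {m} {H : Adj m} {f : Fin m → Fin m} (aut : IsAutomorphism H f) where

  inverse : Fin m → Fin m
  inverse y = proj₁ (injective⇒surjective f (injective aut) y)

  inverse-rightInverse : ∀ y → f (inverse y) ≡ y
  inverse-rightInverse y = proj₂ (injective⇒surjective f (injective aut) y)

  inverse-leftInverse : ∀ x → inverse (f x) ≡ x
  inverse-leftInverse x = injective aut (inverse-rightInverse (f x))

  inverse-automorphism : IsAutomorphism H inverse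
  inverse-automorphism = record
    { preserves-adj = λ a b → trans (sym (preserves-adj aut (inverse a) (inverse b)))
                                    (cong₂ H (inverse-rightInverse a) (inverse-rightInverse b))
    ; injective     = λ {a} {b} eq → trans (sym (inverse-rightInverse a))
                                           (trans (cong f eq) (inverse-rightInverse b))
    }

Simplicial : ∀ {m} → Adj m → Fin m → Set
Simplicial H x = ∀ a b → H x a ≡ true → H x b ≡ true → a ≢ b → H a b ≡ true

NonSimplicial : ∀ {m} → Adj m → Fin m → Set
NonSimplicial H x = ∃[ a ] ∃[ b ] (H x a ≡ true × H x b ≡ true × a ≢ b × H a b ≡ false)

nonSimplicial⇒¬simplicial : ∀ {m} {H : Adj m} {x} → NonSimplicial H x → ¬ Simplicial H x
nonSimplicial⇒¬simplicial (a , b , xa , xb , a≢b , ab) simp = true≢false (simp a b xa xb a≢b) ab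

automorphism-nonSimplicial : ∀ {m} {H : Adj m} {f} → IsAutomorphism H f → ∀ {x} →
                             NonSimplicial H x → NonSimplicial H (f x)
automorphism-nonSimplicial {f = f} aut {x} (a , b , xa , xb , a≢b , ab) =
  f a , f b , trans (preserves-adj aut x a) xa , trans (preserves-adj aut x b) xb ,
  a≢b ∘ injective aut , trans (preserves-adj aut a b) ab

automorphism-nonSimplicial⁻¹ : ∀ {m} {H : Adj m} {f} → IsAutomorphism H f → ∀ {x} →
                               NonSimplicial H (f x) → NonSimplicial H x
automorphism-nonSimplicial⁻¹ {H = H} aut {x} ns =
  subst (NonSimplicial H) (inverse-leftInverse aut x) (automorphism-nonSimplicial (inverse-automorphism aut) ns)

module _ {m} (H : Adj m) where

  any-aut⇒ : ∀ (p : (Fin m → Fin m) → Bool) → any p (autList H) ≡ true →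
             ∃[ f ] (IsAutomorphism H f × p f ≡ true)
  any-aut⇒ p e = let f , aut , pf = any-filterᵇ⇒ (isAut H) p (allFuns m m) e
                 in f , isAut⇒IsAutomorphism H f aut , pf

  any-aut-intro : ∀ (p : (Fin m → Fin m) → Bool) → Respects (allFunsEnum m m) p →
                  ∀ f → IsAutomorphism H f → p f ≡ true → any p (autList H) ≡ true
  any-aut-intro p resp f aut pf =
    any-filterᵇ-intro (isAut H) p (allFuns m m) (λ none → 1≰0 (subst (1 ≤_) none f-counted))
    where
    1≰0 : ¬ 1 ≤ 0
    1≰0 ()
    -- allFuns m m contains a function pointwise equal to f, not necessarily f itself.
    f-counted : 1 ≤ count (λ g → isAut H g ∧ p g) (allFuns m m)
    f-counted = subst (_≤ count (λ g → isAut H g ∧ p g) (allFuns m m)) (occurs-once (allFunsEnum m m) f)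
      (count-mono (same (allFunsEnum m m) f) _ (allFuns m m) (λ g f≈g →
        ∧-intro (trans (sym (isAut-respects H f g f≈g)) (IsAutomorphism⇒isAut H f aut))
                (trans (sym (resp f g f≈g)) pf)))

  SameVertexOrbit : Fin m → Fin m → Set
  SameVertexOrbit u v = ∃[ f ] (IsAutomorphism H f × f u ≡ v)

  sameVertexOrbit⇒ : ∀ u v → sameVertexOrbit H u v ≡ true → SameVertexOrbit u v
  sameVertexOrbit⇒ u v e = let f , aut , fu = any-aut⇒ (λ f → f u ==ᶠ v) e in f , aut , ==ᶠ⇒≡ fu

  sameVertexOrbit-intro : ∀ u v → SameVertexOrbit u v → sameVertexOrbit H u v ≡ true
  sameVertexOrbit-intro u v (f , aut , fu) =
    any-aut-intro (λ f → f u ==ᶠ v) (λ f f′ e → cong (_==ᶠ v) (same-allFuns⇒ f f′ e u))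
                  f aut (≡⇒==ᶠ fu)

  SameEdgeOrbit : Fin m → Fin m → Fin m → Fin m → Set
  SameEdgeOrbit u v x y = ∃[ f ] (IsAutomorphism H f × ((f u ≡ x × f v ≡ y) ⊎ (f u ≡ y × f v ≡ x)))

  private
    mapsEdge : Fin m → Fin m → Fin m → Fin m → (Fin m → Fin m) → Bool
    mapsEdge u v x y f = ((f u ==ᶠ x) ∧ (f v ==ᶠ y)) ∨ ((f u ==ᶠ y) ∧ (f v ==ᶠ x))

  sameEdgeOrbit⇒ : ∀ u v x y → sameEdgeOrbit H u v x y ≡ true → SameEdgeOrbit u v x y
  sameEdgeOrbit⇒ u v x y e with any-aut⇒ (mapsEdge u v x y) e
  ... | f , aut , hit with ∨-elim ((f u ==ᶠ x) ∧ (f v ==ᶠ y)) hit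
  ...   | inj₁ straight =
    f , aut , inj₁ (==ᶠ⇒≡ (∧-elimˡ (f u ==ᶠ x) straight) , ==ᶠ⇒≡ (∧-elimʳ (f u ==ᶠ x) straight))
  ...   | inj₂ crossed  =
    f , aut , inj₂ (==ᶠ⇒≡ (∧-elimˡ (f u ==ᶠ y) crossed) , ==ᶠ⇒≡ (∧-elimʳ (f u ==ᶠ y) crossed))

  sameEdgeOrbit-intro : ∀ u v x y → SameEdgeOrbit u v x y → sameEdgeOrbit H u v x y ≡ true
  sameEdgeOrbit-intro u v x y (f , aut , images) = any-aut-intro (mapsEdge u v x y)
    (λ f f′ e → cong₂ (λ a b → ((a ==ᶠ x) ∧ (b ==ᶠ y)) ∨ ((a ==ᶠ y) ∧ (b ==ᶠ x)))
                      (same-allFuns⇒ f f′ e u) (same-allFuns⇒ f f′ e v))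
    f aut (hit images)
    where
    hit : (f u ≡ x × f v ≡ y) ⊎ (f u ≡ y × f v ≡ x) → mapsEdge u v x y f ≡ true
    hit (inj₁ (fu , fv)) = ∨-introˡ ((f u ==ᶠ y) ∧ (f v ==ᶠ x)) (∧-intro (≡⇒==ᶠ fu) (≡⇒==ᶠ fv))
    hit (inj₂ (fu , fv)) = ∨-introʳ ((f u ==ᶠ x) ∧ (f v ==ᶠ y)) (∧-intro (≡⇒==ᶠ fu) (≡⇒==ᶠ fv))

  SameEdgeOrbit⇒SameVertexOrbit : ∀ {a b x y} → SameEdgeOrbit a b x y → SameVertexOrbit a x ⊎ SameVertexOrbit a y
  SameEdgeOrbit⇒SameVertexOrbit (f , aut , inj₁ (fa , _)) = inj₁ (f , aut , fa)
  SameEdgeOrbit⇒SameVertexOrbit (f , aut , inj₂ (fa , _)) = inj₂ (f , aut , fa)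

  isVertexOrbitRep : Fin m → Bool
  isVertexOrbitRep v = not (anyFin m (λ u → (toℕ u <ᵇ toℕ v) ∧ sameVertexOrbit H u v))

  VertexOrbitRep : Fin m → Set
  VertexOrbitRep v = ∀ u → toℕ u < toℕ v → ¬ SameVertexOrbit u v

  isVertexOrbitRep⇒ : ∀ v → isVertexOrbitRep v ≡ true → VertexOrbitRep v
  isVertexOrbitRep⇒ v e u u<v same =
    true≢false (anyFin-intro m u (∧-intro (<⇒<ᵇ u<v) (sameVertexOrbit-intro u v same))) (not-true⇒false e)

  isVertexOrbitRep-intro : ∀ v → VertexOrbitRep v → isVertexOrbitRep v ≡ true
  isVertexOrbitRep-intro v rep = cong not (anyFin-false m (λ u → ¬true⇒false (λ e →
    rep u (<ᵇ⇒< (∧-elimˡ (toℕ u <ᵇ toℕ v) e)) (sameVertexOrbit⇒ u v (∧-elimʳ (toℕ u <ᵇ toℕ v) e)))))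

  LexLt : Fin m → Fin m → Fin m → Fin m → Set
  LexLt u v x y = toℕ u < toℕ x ⊎ (u ≡ x × toℕ v < toℕ y)

  lexLt⇒ : ∀ u v x y → lexLt u v x y ≡ true → LexLt u v x y
  lexLt⇒ u v x y e with ∨-elim (toℕ u <ᵇ toℕ x) e
  ... | inj₁ u<x = inj₁ (<ᵇ⇒< u<x)
  ... | inj₂ tie = inj₂ (==ᶠ⇒≡ (∧-elimˡ (u ==ᶠ x) tie) , <ᵇ⇒< (∧-elimʳ (u ==ᶠ x) tie))

  lexLt-intro : ∀ u v x y → LexLt u v x y → lexLt u v x y ≡ true
  lexLt-intro u v x y (inj₁ u<x)        = ∨-introˡ ((u ==ᶠ x) ∧ (toℕ v <ᵇ toℕ y)) (<⇒<ᵇ u<x)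
  lexLt-intro u v x y (inj₂ (u≡x , v<y)) =
    ∨-introʳ (toℕ u <ᵇ toℕ x) (∧-intro (≡⇒==ᶠ u≡x) (<⇒<ᵇ v<y))

  Edge : Fin m → Fin m → Set
  Edge u v = toℕ u < toℕ v × H u v ≡ true

  isEdge⇒ : ∀ u v → isEdge H u v ≡ true → Edge u v
  isEdge⇒ u v e = <ᵇ⇒< (∧-elimˡ (toℕ u <ᵇ toℕ v) e) , ∧-elimʳ (toℕ u <ᵇ toℕ v) e

  isEdge-intro : ∀ u v → Edge u v → isEdge H u v ≡ true
  isEdge-intro u v (u<v , uv) = ∧-intro (<⇒<ᵇ u<v) uv

  isEdgeOrbitRep : Fin m → Fin m → Bool
  isEdgeOrbitRep x y = isEdge H x y ∧ not (anyFin m (λ u → anyFin m (λ v →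
    isEdge H u v ∧ lexLt u v x y ∧ sameEdgeOrbit H u v x y)))

  LeastInEdgeOrbit : Fin m → Fin m → Set
  LeastInEdgeOrbit x y = ∀ u v → Edge u v → LexLt u v x y → ¬ SameEdgeOrbit u v x y

  isEdgeOrbitRep⇒ : ∀ x y → isEdgeOrbitRep x y ≡ true → Edge x y × LeastInEdgeOrbit x y
  isEdgeOrbitRep⇒ x y e = isEdge⇒ x y (∧-elimˡ (isEdge H x y) e) , λ u v uv u<x same →
    true≢false (anyFin-intro m u (anyFin-intro m v (∧-intro (isEdge-intro u v uv)
                 (∧-intro (lexLt-intro u v x y u<x) (sameEdgeOrbit-intro u v x y same)))))
               (not-true⇒false (∧-elimʳ (isEdge H x y) e))

  isEdgeOrbitRep-intro : ∀ x y → Edge x y → LeastInEdgeOrbit x y → isEdgeOrbitRep x y ≡ true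
  isEdgeOrbitRep-intro x y xy least = ∧-intro (isEdge-intro x y xy)
    (cong not (anyFin-false m (λ u → anyFin-false m (λ v → ¬true⇒false (λ e →
      let rest = ∧-elimʳ (isEdge H u v) e in
      least u v (isEdge⇒ u v (∧-elimˡ (isEdge H u v) e)) (lexLt⇒ u v x y (∧-elimˡ (lexLt u v x y) rest))
                (sameEdgeOrbit⇒ u v x y (∧-elimʳ (lexLt u v x y) rest)))))))

  isEdgeOrbitRep-nonEdge : ∀ x y → ¬ Edge x y → isEdgeOrbitRep x y ≡ false
  isEdgeOrbitRep-nonEdge x y ¬xy = ¬true⇒false (¬xy ∘ proj₁ ∘ isEdgeOrbitRep⇒ x y)

-- The graph M3 t G

-- Vertex ⟨ v , zero ⟩ of M3 t G is the original vertex v and ⟨ v , suc j ⟩ is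
-- triangle vertex j at v; t = suc t′ makes the triangle vertices 0 and 1 exist.
module Fused (t′ n : ℕ) (G : Adj n) (loopless : ∀ v → G v v ≡ false)
             (neighbour : ∀ v → ∃[ w ] G v w ≡ true) where

  t T K N : ℕ
  t = suc t′
  T = t * 2
  K = suc T
  N = n * K

  open Blocks t public

  M : Adj N
  M = M3 t G

  ⟨_,_⟩ : Fin n → Fin K → Fin N
  ⟨ v , j ⟩ = combine {n} v j

  host : Fin N → Fin n
  host p = proj₁ (remQuot {n} K p)

  index : Fin N → Fin K
  index p = proj₂ (remQuot {n} K p)

  host-⟨⟩ : ∀ v j → host ⟨ v , j ⟩ ≡ v
  host-⟨⟩ v j = cong proj₁ (Fin.remQuot-combine v j)

  index-⟨⟩ : ∀ v j → index ⟨ v , j ⟩ ≡ j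
  index-⟨⟩ v j = cong proj₂ (Fin.remQuot-combine v j)

  ⟨host,index⟩ : ∀ p → ⟨ host p , index p ⟩ ≡ p
  ⟨host,index⟩ = Fin.combine-remQuot {n} K

  ⟨host,index⟩-with : ∀ {p k} → index p ≡ k → p ≡ ⟨ host p , k ⟩
  ⟨host,index⟩-with {p} refl = sym (⟨host,index⟩ p)

  ⟨⟩-injective : ∀ {v j w k} → ⟨ v , j ⟩ ≡ ⟨ w , k ⟩ → v ≡ w × j ≡ k
  ⟨⟩-injective = Fin.combine-injective _ _ _ _

  ⟨⟩-elim : ∀ (P : Fin N → Set) → (∀ v j → P ⟨ v , j ⟩) → ∀ p → P p
  ⟨⟩-elim P h p = subst P (⟨host,index⟩ p) (h (host p) (index p))

  ⟨⟩-elim₂ : ∀ (P : Fin N → Fin N → Set) → (∀ v j w k → P ⟨ v , j ⟩ ⟨ w , k ⟩) →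
             ∀ p q → P p q
  ⟨⟩-elim₂ P h p q = ⟨⟩-elim (λ p → P p q) (λ v j → ⟨⟩-elim (P ⟨ v , j ⟩) (h v j) q) p

  M-orig-orig : ∀ v w → M ⟨ v , zero ⟩ ⟨ w , zero ⟩ ≡ G v w
  M-orig-orig v w rewrite Fin.remQuot-combine {n} {K} v zero | Fin.remQuot-combine {n} {K} w zero = refl

  M-orig-tri : ∀ v w k → M ⟨ v , zero ⟩ ⟨ w , suc k ⟩ ≡ (v ==ᶠ w)
  M-orig-tri v w k rewrite Fin.remQuot-combine {n} {K} v zero | Fin.remQuot-combine {n} {K} w (suc k) = refl

  M-tri-orig : ∀ v j w → M ⟨ v , suc j ⟩ ⟨ w , zero ⟩ ≡ (v ==ᶠ w)
  M-tri-orig v j w rewrite Fin.remQuot-combine {n} {K} v (suc j) | Fin.remQuot-combine {n} {K} w zero = refl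

  M-tri-tri : ∀ v j w k →
    M ⟨ v , suc j ⟩ ⟨ w , suc k ⟩ ≡ (v ==ᶠ w) ∧ (block j ==ᶠ block k) ∧ not (side j ==ᶠ side k)
  M-tri-tri v j w k rewrite Fin.remQuot-combine {n} {K} v (suc j) | Fin.remQuot-combine {n} {K} w (suc k) = refl

  Triangle : Fin T → Fin T → Set
  Triangle j k = block j ≡ block k × j ≢ k

  triangleᵇ⇒ : ∀ j k → (block j ==ᶠ block k) ∧ not (side j ==ᶠ side k) ≡ true → Triangle j k
  triangleᵇ⇒ j k e = ==ᶠ⇒≡ (∧-elimˡ (block j ==ᶠ block k) e) ,
    λ { refl → true≢false (==ᶠ-refl (side j)) (not-true⇒false (∧-elimʳ (block j ==ᶠ block k) e)) }

  triangleᵇ-intro : ∀ j k → Triangle j k → (block j ==ᶠ block k) ∧ not (side j ==ᶠ side k) ≡ true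
  triangleᵇ-intro j k (j~k , j≢k) =
    ∧-intro (≡⇒==ᶠ j~k) (cong not (≢⇒==ᶠ-false (j≢k ∘ block-side-injective j~k)))

  M-tri-tri⇒ : ∀ v j w k → M ⟨ v , suc j ⟩ ⟨ w , suc k ⟩ ≡ true → v ≡ w × Triangle j k
  M-tri-tri⇒ v j w k e = let e′ = trans (sym (M-tri-tri v j w k)) e in
    ==ᶠ⇒≡ (∧-elimˡ (v ==ᶠ w) e′) , triangleᵇ⇒ j k (∧-elimʳ (v ==ᶠ w) e′)

  M-tri-tri-intro : ∀ v j k → Triangle j k → M ⟨ v , suc j ⟩ ⟨ v , suc k ⟩ ≡ true
  M-tri-tri-intro v j k jk = trans (M-tri-tri v j v k) (∧-intro (==ᶠ-refl v) (triangleᵇ-intro j k jk))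

  original-nonSimplicial : ∀ v → NonSimplicial M ⟨ v , zero ⟩
  original-nonSimplicial v with neighbour v
  ... | w , vw = ⟨ v , suc zero ⟩ , ⟨ w , zero ⟩ ,
    trans (M-orig-tri v v zero) (==ᶠ-refl v) , trans (M-orig-orig v w) vw ,
    (λ eq → suc≢zero (proj₂ (⟨⟩-injective eq))) ,
    trans (M-tri-orig v zero w) (≢⇒==ᶠ-false λ { refl → true≢false vw (loopless v) })
    where
    suc≢zero : ∀ {i : Fin T} → suc i ≢ zero
    suc≢zero ()

  triangle-neighbours : ∀ v j p → M ⟨ v , suc j ⟩ p ≡ true →
                        p ≡ ⟨ v , zero ⟩ ⊎ p ≡ ⟨ v , suc (partner j) ⟩
  triangle-neighbours v j = ⟨⟩-elim _ cases
    where
    cases : ∀ w k → M ⟨ v , suc j ⟩ ⟨ w , k ⟩ ≡ true →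
            ⟨ w , k ⟩ ≡ ⟨ v , zero ⟩ ⊎ ⟨ w , k ⟩ ≡ ⟨ v , suc (partner j) ⟩
    cases w zero    e = inj₁ (cong ⟨_, zero ⟩ (sym (==ᶠ⇒≡ (trans (sym (M-tri-orig v j w)) e))))
    cases w (suc k) e with M-tri-tri⇒ v j w k e
    ... | refl , (j~k , j≢k) = inj₂ (cong (λ x → ⟨ v , suc x ⟩) (≡partner j~k j≢k))

  triangle-simplicial : ∀ v j → Simplicial M ⟨ v , suc j ⟩
  triangle-simplicial v j a b va vb a≢b with triangle-neighbours v j a va | triangle-neighbours v j b vb
  ... | inj₁ refl | inj₁ refl = ⊥-elim (a≢b refl)
  ... | inj₁ refl | inj₂ refl = trans (M-orig-tri v v _) (==ᶠ-refl v)
  ... | inj₂ refl | inj₁ refl = trans (M-tri-orig v _ v) (==ᶠ-refl v)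
  ... | inj₂ refl | inj₂ refl = ⊥-elim (a≢b refl)

  -- The zero case is junk: it is only applied to indices of triangle vertices.
  predᶠ : Fin K → Fin T
  predᶠ zero    = zero
  predᶠ (suc k) = k

  baseMap : (Fin N → Fin N) → Fin n → Fin n
  baseMap f v = host (f ⟨ v , zero ⟩)

  fibreMap : (Fin N → Fin N) → Fin n → Fin T → Fin T
  fibreMap f v j = predᶠ (index (f ⟨ v , suc j ⟩))

  -- Original vertices are exactly the non-simplicial ones, so automorphisms keep
  -- the two layers apart; adjacency to the original vertex keeps each bouquet together.
  module Restriction {f : Fin N → Fin N} (aut : IsAutomorphism M f) where

    original↦original : ∀ v → f ⟨ v , zero ⟩ ≡ ⟨ baseMap f v , zero ⟩
    original↦original v with index (f ⟨ v , zero ⟩) in e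
    ... | zero  = ⟨host,index⟩-with e
    ... | suc k = ⊥-elim (nonSimplicial⇒¬simplicial (automorphism-nonSimplicial aut (original-nonSimplicial v))
      (subst (Simplicial M) (sym (⟨host,index⟩-with e)) (triangle-simplicial _ k)))

    index-triangle : ∀ v j → ∃[ k ] index (f ⟨ v , suc j ⟩) ≡ suc k
    index-triangle v j with index (f ⟨ v , suc j ⟩) in e
    ... | suc k = k , refl
    ... | zero  = ⊥-elim (nonSimplicial⇒¬simplicial
      (automorphism-nonSimplicial⁻¹ aut
        (subst (NonSimplicial M) (sym (⟨host,index⟩-with e)) (original-nonSimplicial _)))
      (triangle-simplicial v j))

    triangle↦triangle : ∀ v j → f ⟨ v , suc j ⟩ ≡ ⟨ baseMap f v , suc (fibreMap f v j) ⟩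
    triangle↦triangle v j with index-triangle v j
    ... | k , e = trans (⟨host,index⟩-with e) (cong₂ (λ w i → ⟨ w , suc i ⟩) same-host (sym (cong predᶠ e)))
      where
      adjacent : M ⟨ baseMap f v , zero ⟩ ⟨ host (f ⟨ v , suc j ⟩) , suc k ⟩ ≡ true
      adjacent = subst₂ (λ a b → M a b ≡ true) (original↦original v) (⟨host,index⟩-with e)
        (trans (preserves-adj aut _ _) (trans (M-orig-tri v v j) (==ᶠ-refl v)))
      same-host : host (f ⟨ v , suc j ⟩) ≡ baseMap f v
      same-host = sym (==ᶠ⇒≡ (trans (sym (M-orig-tri _ _ k)) adjacent))

    baseMap-automorphism : IsAutomorphism G (baseMap f)
    baseMap-automorphism = record
      { preserves-adj = λ u v → begin
          G (baseMap f u) (baseMap f v)                    ≡⟨ sym (M-orig-orig _ _) ⟩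
          M ⟨ baseMap f u , zero ⟩ ⟨ baseMap f v , zero ⟩
            ≡⟨ sym (cong₂ M (original↦original u) (original↦original v)) ⟩
          M (f ⟨ u , zero ⟩) (f ⟨ v , zero ⟩)              ≡⟨ preserves-adj aut _ _ ⟩
          M ⟨ u , zero ⟩ ⟨ v , zero ⟩                      ≡⟨ M-orig-orig u v ⟩
          G u v                                            ∎
      ; injective = λ {u} {v} eq → proj₁ (⟨⟩-injective (injective aut
          (trans (original↦original u) (trans (cong ⟨_, zero ⟩ eq) (sym (original↦original v))))))
      }
      where open ≡-Reasoning

    fibreMap-hyperoctahedral : ∀ v → isHyperoctahedralᵇ (fibreMap f v) ≡ true
    fibreMap-hyperoctahedral v = hyperoctahedral-intro _ inj pres
      where
      inj : Injective _≡_ _≡_ (fibreMap f v)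
      inj {j} {j′} eq = Fin.suc-injective (proj₂ (⟨⟩-injective (injective aut (trans (triangle↦triangle v j)
        (trans (cong (λ x → ⟨ baseMap f v , suc x ⟩) eq) (sym (triangle↦triangle v j′)))))))
      pres : PreservesBlocks (fibreMap f v)
      pres j j′ j~j′ with j Fin.≟ j′
      ... | yes refl = refl
      ... | no  j≢j′ = proj₁ (proj₂ (M-tri-tri⇒ _ _ _ _ (begin
        M ⟨ baseMap f v , suc (fibreMap f v j) ⟩ ⟨ baseMap f v , suc (fibreMap f v j′) ⟩
          ≡⟨ sym (cong₂ M (triangle↦triangle v j) (triangle↦triangle v j′)) ⟩
        M (f ⟨ v , suc j ⟩) (f ⟨ v , suc j′ ⟩)  ≡⟨ preserves-adj aut _ _ ⟩
        M ⟨ v , suc j ⟩ ⟨ v , suc j′ ⟩          ≡⟨ M-tri-tri-intro v j j′ (j~j′ , j≢j′) ⟩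
        true                                     ∎)))
        where open ≡-Reasoning

  lift : (Fin n → Fin n) → (Fin n → Fin T → Fin T) → Fin N → Fin N
  lift σ π p = on (remQuot {n} K p)
    where
    on : Fin n × Fin K → Fin N
    on (v , zero)  = ⟨ σ v , zero ⟩
    on (v , suc j) = ⟨ σ v , suc (π v j) ⟩

  lift-original : ∀ σ π v → lift σ π ⟨ v , zero ⟩ ≡ ⟨ σ v , zero ⟩
  lift-original σ π v rewrite Fin.remQuot-combine {n} {K} v zero = refl

  lift-triangle : ∀ σ π v j → lift σ π ⟨ v , suc j ⟩ ≡ ⟨ σ v , suc (π v j) ⟩
  lift-triangle σ π v j rewrite Fin.remQuot-combine {n} {K} v (suc j) = refl

  hyperoctahedral-triangle : ∀ {π} → isHyperoctahedralᵇ π ≡ true → ∀ j k →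
    (block (π j) ==ᶠ block (π k)) ∧ not (side (π j) ==ᶠ side (π k)) ≡
    (block j ==ᶠ block k) ∧ not (side j ==ᶠ side k)
  hyperoctahedral-triangle {π} h j k = bool-ext
    (λ e → let πj~πk , πj≢πk = triangleᵇ⇒ (π j) (π k) e in
           triangleᵇ-intro j k (hyperoctahedral-reflectsBlocks {π} h j k πj~πk , πj≢πk ∘ cong π))
    (λ e → let j~k , j≢k = triangleᵇ⇒ j k e in
           triangleᵇ-intro (π j) (π k)
             (hyperoctahedral⇒preservesBlocks {π} h j k j~k , j≢k ∘ hyperoctahedral⇒injective {π} h))

  module Lift {σ : Fin n → Fin n} {π : Fin n → Fin T → Fin T}
              (σ-aut : IsAutomorphism G σ) (π-hyp : ∀ v → isHyperoctahedralᵇ (π v) ≡ true) where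

    ==ᶠ-σ : ∀ v w → (σ v ==ᶠ σ w) ≡ (v ==ᶠ w)
    ==ᶠ-σ v w = bool-ext (≡⇒==ᶠ ∘ injective σ-aut ∘ ==ᶠ⇒≡) (≡⇒==ᶠ ∘ cong σ ∘ ==ᶠ⇒≡)

    lift-adj : ∀ v i w k → M (lift σ π ⟨ v , i ⟩) (lift σ π ⟨ w , k ⟩) ≡ M ⟨ v , i ⟩ ⟨ w , k ⟩
    lift-adj v zero w zero rewrite lift-original σ π v | lift-original σ π w =
      trans (M-orig-orig _ _) (trans (preserves-adj σ-aut v w) (sym (M-orig-orig v w)))
    lift-adj v zero w (suc k) rewrite lift-original σ π v | lift-triangle σ π w k =
      trans (M-orig-tri _ _ _) (trans (==ᶠ-σ v w) (sym (M-orig-tri v w k)))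
    lift-adj v (suc j) w zero rewrite lift-triangle σ π v j | lift-original σ π w =
      trans (M-tri-orig _ _ _) (trans (==ᶠ-σ v w) (sym (M-tri-orig v j w)))
    lift-adj v (suc j) w (suc k) rewrite lift-triangle σ π v j | lift-triangle σ π w k =
      trans (M-tri-tri _ _ _ _) (trans (same-host (==ᶠ-σ v w)) (sym (M-tri-tri v j w k)))
      where
      same-host : ∀ {a} → a ≡ (v ==ᶠ w) →
                  a ∧ (block (π v j) ==ᶠ block (π w k)) ∧ not (side (π v j) ==ᶠ side (π w k)) ≡
                  (v ==ᶠ w) ∧ (block j ==ᶠ block k) ∧ not (side j ==ᶠ side k)
      same-host refl with v Fin.≟ w
      ... | yes refl = hyperoctahedral-triangle {π v} (π-hyp v) j k
      ... | no  _    = refl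

    lift-injective : ∀ v i w k → lift σ π ⟨ v , i ⟩ ≡ lift σ π ⟨ w , k ⟩ →
                     ⟨ v , i ⟩ ≡ ⟨ w , k ⟩
    lift-injective v zero w zero eq rewrite lift-original σ π v | lift-original σ π w =
      cong ⟨_, zero ⟩ (injective σ-aut (proj₁ (⟨⟩-injective eq)))
    lift-injective v zero w (suc k) eq rewrite lift-original σ π v | lift-triangle σ π w k
      with () ← proj₂ (⟨⟩-injective eq)
    lift-injective v (suc j) w zero eq rewrite lift-triangle σ π v j | lift-original σ π w
      with () ← proj₂ (⟨⟩-injective eq)
    lift-injective v (suc j) w (suc k) eq rewrite lift-triangle σ π v j | lift-triangle σ π w k
      with refl ← injective σ-aut (proj₁ (⟨⟩-injective eq)) =
      cong (λ x → ⟨ v , suc x ⟩)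
           (hyperoctahedral⇒injective {π v} (π-hyp v) (Fin.suc-injective (proj₂ (⟨⟩-injective eq))))

    lift-automorphism : IsAutomorphism M (lift σ π)
    lift-automorphism = record
      { preserves-adj = ⟨⟩-elim₂ (λ p q → M (lift σ π p) (lift σ π q) ≡ M p q) lift-adj
      ; injective     = λ {p} {q} →
          ⟨⟩-elim₂ (λ p q → lift σ π p ≡ lift σ π q → p ≡ q) lift-injective p q
      }

  -- An automorphism of M3 t G is the same as an automorphism σ of G together with
  -- an independent hyperoctahedral map of each bouquet.
  count-automorphisms : count (isAut M) (allFuns N N) ≡ count (isAut G) (allFuns n n) * (t ! * 2 ^ t) ^ n
  count-automorphisms = trans
    (count-bijection (allFunsEnum N N) E′ (isAut M) compatible (isAut-respects M) compatible-respects
      decompose compose decompose-preserves compose-preserves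
      decompose-compatible compose-automorphism compose-decompose decompose-compose)
    (trans (count-pairs (isAut G) (λ π → allFin n (λ v → isHyperoctahedralᵇ (π v)))
                        (allFuns n n) (tuples n (allFuns T T)))
      (cong (count (isAut G) (allFuns n n) *_)
        (count-tuples n (λ _ → isHyperoctahedralᵇ) (allFuns T T) _ (λ _ → count-hyperoctahedral))))
    where
    E′ = ×-enum (allFunsEnum n n) (tupleEnum n (allFunsEnum T T))

    compatible : (Fin n → Fin n) × (Fin n → Fin T → Fin T) → Bool
    compatible (σ , π) = isAut G σ ∧ allFin n (λ v → isHyperoctahedralᵇ (π v))

    compatible-respects : Respects E′ compatible
    compatible-respects (σ , π) (σ′ , π′) e = cong₂ _∧_ (isAut-respects G σ σ′ σ≈σ′)
      (allFin-cong n (λ v → isHyperoctahedralᵇ-respects (π v) (π′ v) (allFin⇒ n π≈π′ v)))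
      where
      σ≈σ′ = ∧-elimˡ (same (allFunsEnum n n) σ σ′) e
      π≈π′ = ∧-elimʳ (same (allFunsEnum n n) σ σ′) e

    decompose : (Fin N → Fin N) → (Fin n → Fin n) × (Fin n → Fin T → Fin T)
    decompose f = baseMap f , fibreMap f

    compose : (Fin n → Fin n) × (Fin n → Fin T → Fin T) → (Fin N → Fin N)
    compose (σ , π) = lift σ π

    decompose-preserves : Preserves (allFunsEnum N N) E′ decompose
    decompose-preserves f f′ e = ∧-intro
      (pointwise⇒same-allFuns _ _ (λ v → cong host (same-allFuns⇒ f f′ e ⟨ v , zero ⟩)))
      (allFin-intro n (λ v → pointwise⇒same-allFuns _ _ (λ j →
        cong (predᶠ ∘ index) (same-allFuns⇒ f f′ e ⟨ v , suc j ⟩))))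

    compose-preserves : Preserves E′ (allFunsEnum N N) compose
    compose-preserves (σ , π) (σ′ , π′) e =
      pointwise⇒same-allFuns _ _ (⟨⟩-elim (λ p → lift σ π p ≡ lift σ′ π′ p) agree)
      where
      σ≈σ′ = same-allFuns⇒ σ σ′ (∧-elimˡ (same (allFunsEnum n n) σ σ′) e)
      π≈π′ : ∀ v → ∀ j → π v j ≡ π′ v j
      π≈π′ v = same-allFuns⇒ (π v) (π′ v) (allFin⇒ n (∧-elimʳ (same (allFunsEnum n n) σ σ′) e) v)
      agree : ∀ v j → lift σ π ⟨ v , j ⟩ ≡ lift σ′ π′ ⟨ v , j ⟩
      agree v zero    = trans (lift-original σ π v)
        (trans (cong ⟨_, zero ⟩ (σ≈σ′ v)) (sym (lift-original σ′ π′ v)))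
      agree v (suc j) = trans (lift-triangle σ π v j)
        (trans (cong₂ (λ a b → ⟨ a , suc b ⟩) (σ≈σ′ v) (π≈π′ v j)) (sym (lift-triangle σ′ π′ v j)))

    decompose-compatible : ∀ f → isAut M f ≡ true → compatible (decompose f) ≡ true
    decompose-compatible f e = ∧-intro (IsAutomorphism⇒isAut G _ baseMap-automorphism)
                                       (allFin-intro n fibreMap-hyperoctahedral)
      where open Restriction (isAut⇒IsAutomorphism M f e)

    compose-automorphism : ∀ σπ → compatible σπ ≡ true → isAut M (compose σπ) ≡ true
    compose-automorphism (σ , π) e = IsAutomorphism⇒isAut M _ (Lift.lift-automorphism
      (isAut⇒IsAutomorphism G σ (∧-elimˡ (isAut G σ) e)) (allFin⇒ n (∧-elimʳ (isAut G σ) e)))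

    compose-decompose : ∀ f → isAut M f ≡ true → same (allFunsEnum N N) (compose (decompose f)) f ≡ true
    compose-decompose f e =
      pointwise⇒same-allFuns _ _ (⟨⟩-elim (λ p → lift (baseMap f) (fibreMap f) p ≡ f p) agree)
      where
      open Restriction (isAut⇒IsAutomorphism M f e)
      agree : ∀ v j → lift (baseMap f) (fibreMap f) ⟨ v , j ⟩ ≡ f ⟨ v , j ⟩
      agree v zero    = trans (lift-original _ _ v) (sym (original↦original v))
      agree v (suc j) = trans (lift-triangle _ _ v j) (sym (triangle↦triangle v j))

    decompose-compose : ∀ σπ → compatible σπ ≡ true → same E′ (decompose (compose σπ)) σπ ≡ true
    decompose-compose (σ , π) _ = ∧-intro
      (pointwise⇒same-allFuns _ σ (λ v → trans (cong host (lift-original σ π v)) (host-⟨⟩ _ _)))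
      (allFin-intro n (λ v → pointwise⇒same-allFuns _ (π v) (λ j →
        trans (cong (predᶠ ∘ index) (lift-triangle σ π v j)) (cong predᶠ (index-⟨⟩ _ _)))))

  isOriginal : Fin K → Bool
  isOriginal zero    = true
  isOriginal (suc _) = false

  automorphism-⟨⟩ : ∀ {f} → IsAutomorphism M f → ∀ {u i v j} → f ⟨ u , i ⟩ ≡ ⟨ v , j ⟩ →
                    baseMap f u ≡ v × isOriginal i ≡ isOriginal j
  automorphism-⟨⟩ aut {u} {zero}  eq = map₂ (cong isOriginal)
    (⟨⟩-injective (trans (sym (Restriction.original↦original aut u)) eq))
  automorphism-⟨⟩ aut {u} {suc i} eq = map₂ (cong isOriginal)
    (⟨⟩-injective (trans (sym (Restriction.triangle↦triangle aut u i)) eq))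

  transportLift : (Fin n → Fin n) → Fin T → Fin T → Fin N → Fin N
  transportLift σ j k = lift σ (λ _ → transport j k)

  transportLift-automorphism : ∀ {σ} → IsAutomorphism G σ → ∀ j k → IsAutomorphism M (transportLift σ j k)
  transportLift-automorphism σ-aut j k = Lift.lift-automorphism σ-aut (λ _ → transport-hyperoctahedral j k)

  transportLift-original : ∀ σ j k v → transportLift σ j k ⟨ v , zero ⟩ ≡ ⟨ σ v , zero ⟩
  transportLift-original σ j k = lift-original σ _

  transportLift-triangle : ∀ σ j k v i →
                           transportLift σ j k ⟨ v , suc i ⟩ ≡ ⟨ σ v , suc (transport j k i) ⟩
  transportLift-triangle σ j k = lift-triangle σ _

  transportLift-source : ∀ σ j k v → transportLift σ j k ⟨ v , suc j ⟩ ≡ ⟨ σ v , suc k ⟩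
  transportLift-source σ j k v =
    trans (transportLift-triangle σ j k v j) (cong (λ x → ⟨ σ v , suc x ⟩) (transport-source j k))

  sameVertexOrbit-⟨⟩⇒ : ∀ {u i v j} → SameVertexOrbit M ⟨ u , i ⟩ ⟨ v , j ⟩ →
                        SameVertexOrbit G u v × isOriginal i ≡ isOriginal j
  sameVertexOrbit-⟨⟩⇒ (f , aut , eq) = let σu≡v , layer = automorphism-⟨⟩ aut eq in
    (baseMap f , Restriction.baseMap-automorphism aut , σu≡v) , layer

  sameVertexOrbit-⟨⟩-intro : ∀ {u v} i j → SameVertexOrbit G u v → isOriginal i ≡ isOriginal j →
                             SameVertexOrbit M ⟨ u , i ⟩ ⟨ v , j ⟩
  sameVertexOrbit-⟨⟩-intro {u} zero zero (σ , σ-aut , σu≡v) _ =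
    transportLift σ zero zero , transportLift-automorphism σ-aut zero zero ,
    trans (transportLift-original σ zero zero u) (cong ⟨_, zero ⟩ σu≡v)
  sameVertexOrbit-⟨⟩-intro {u} (suc i) (suc j) (σ , σ-aut , σu≡v) _ =
    transportLift σ i j , transportLift-automorphism σ-aut i j ,
    trans (transportLift-source σ i j u) (cong ⟨_, suc j ⟩ σu≡v)

  -- The hyperoctahedral maps act transitively on each bouquet, so the orbit
  -- representatives are ⟨ v , 0 ⟩ and ⟨ v , 1 ⟩ for the representatives v of G.
  vertexRep-original : ∀ v → isVertexOrbitRep M ⟨ v , zero ⟩ ≡ isVertexOrbitRep G v
  vertexRep-original v = bool-ext
    (λ e → isVertexOrbitRep-intro G v λ u u<v same → isVertexOrbitRep⇒ M _ e ⟨ u , zero ⟩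
      (Fin.combine-monoˡ-< zero zero u<v) (sameVertexOrbit-⟨⟩-intro zero zero same refl))
    (λ e → isVertexOrbitRep-intro M _ (⟨⟩-elim _ (earlier e)))
    where
    earlier : isVertexOrbitRep G v ≡ true → ∀ w k → toℕ ⟨ w , k ⟩ < toℕ ⟨ v , zero ⟩ →
              ¬ SameVertexOrbit M ⟨ w , k ⟩ ⟨ v , zero ⟩
    earlier e w k lt same with sameVertexOrbit-⟨⟩⇒ same | combine-<⇒ w k v zero lt
    earlier e w zero lt same | sameG , _ | inj₁ w<v      = isVertexOrbitRep⇒ G v e w w<v sameG
    earlier e w zero lt same | _     , _ | inj₂ (_ , ())

  vertexRep-firstTriangle : ∀ v → isVertexOrbitRep M ⟨ v , suc zero ⟩ ≡ isVertexOrbitRep G v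
  vertexRep-firstTriangle v = bool-ext
    (λ e → isVertexOrbitRep-intro G v λ u u<v same → isVertexOrbitRep⇒ M _ e ⟨ u , suc zero ⟩
      (Fin.combine-monoˡ-< _ _ u<v) (sameVertexOrbit-⟨⟩-intro (suc zero) (suc zero) same refl))
    (λ e → isVertexOrbitRep-intro M _ (⟨⟩-elim _ (earlier e)))
    where
    earlier : isVertexOrbitRep G v ≡ true → ∀ w k → toℕ ⟨ w , k ⟩ < toℕ ⟨ v , suc zero ⟩ →
              ¬ SameVertexOrbit M ⟨ w , k ⟩ ⟨ v , suc zero ⟩
    earlier e w k lt same with sameVertexOrbit-⟨⟩⇒ same | combine-<⇒ w k v (suc zero) lt
    earlier e w (suc k) lt same | sameG , _ | inj₁ w<v           = isVertexOrbitRep⇒ G v e w w<v sameG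
    earlier e w (suc k) lt same | _     , _ | inj₂ (_ , s≤s ())

  vertexRep-laterTriangle : ∀ v j → isVertexOrbitRep M ⟨ v , suc (suc j) ⟩ ≡ false
  vertexRep-laterTriangle v j = ¬true⇒false λ e → isVertexOrbitRep⇒ M _ e ⟨ v , suc zero ⟩
    (combine-monoʳ-< v (s≤s (s≤s z≤n)))
    (sameVertexOrbit-⟨⟩-intro (suc zero) (suc (suc j)) (id , id-automorphism G , refl) refl)

  vertexOrbits-M3 : vertexOrbits M ≡ 2 * vertexOrbits G
  vertexOrbits-M3 = begin
    vertexOrbits M                                                   ≡⟨ countFin-combine n K (isVertexOrbitRep M) ⟩
    sumFin n (λ v → countFin K (λ j → isVertexOrbitRep M ⟨ v , j ⟩)) ≡⟨ sumFin-cong n reps-at ⟩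
    sumFin n (λ v → 2 * indicator (isVertexOrbitRep G v))            ≡⟨ sumFin-*ˡ n 2 _ ⟩
    2 * sumFin n (λ v → indicator (isVertexOrbitRep G v))            ≡⟨ cong (2 *_) (sym (countFin≡sumFin n _)) ⟩
    2 * vertexOrbits G                                               ∎
    where
    open ≡-Reasoning
    reps-at : ∀ v → countFin K (λ j → isVertexOrbitRep M ⟨ v , j ⟩) ≡ 2 * indicator (isVertexOrbitRep G v)
    reps-at v = cong₂ _+_ (cong indicator (vertexRep-original v))
      (cong₂ _+_ (cong indicator (vertexRep-firstTriangle v)) (countFin-none _ _ (vertexRep-laterTriangle v)))

  side-<⇒ : ∀ {i k} → block i ≡ block k → toℕ i < toℕ k → side i ≡ zero × side k ≡ suc zero
  side-<⇒ {i} {k} i~k i<k = Fin2-< (combine-cancelˡ-< (block i) (subst₂ (λ x y → toℕ x < toℕ y)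
    (sym (slot-block-side i)) (trans (sym (slot-block-side k)) (cong (λ c → slot c (side k)) (sym i~k))) i<k))
    where
    Fin2-< : ∀ {b b′ : Fin 2} → toℕ b < toℕ b′ → b ≡ zero × b′ ≡ suc zero
    Fin2-< {zero}     {suc zero} _ = refl , refl
    Fin2-< {zero}     {zero}     ()
    Fin2-< {suc zero} {zero}     ()
    Fin2-< {suc zero} {suc zero} (s≤s ())

  Edge-orig-orig⇒ : ∀ {v w} → Edge M ⟨ v , zero ⟩ ⟨ w , zero ⟩ → Edge G v w
  Edge-orig-orig⇒ {v} {w} (lt , vw) with combine-<⇒ v zero w zero lt
  ... | inj₁ v<w     = v<w , trans (sym (M-orig-orig v w)) vw
  ... | inj₂ (_ , ())

  Edge-orig-orig-intro : ∀ {v w} → Edge G v w → Edge M ⟨ v , zero ⟩ ⟨ w , zero ⟩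
  Edge-orig-orig-intro {v} {w} (v<w , vw) = Fin.combine-monoˡ-< zero zero v<w , trans (M-orig-orig v w) vw

  Edge-orig-tri⇒ : ∀ {v w k} → Edge M ⟨ v , zero ⟩ ⟨ w , suc k ⟩ → w ≡ v
  Edge-orig-tri⇒ {v} {w} {k} (_ , vw) = sym (==ᶠ⇒≡ (trans (sym (M-orig-tri v w k)) vw))

  Edge-spoke : ∀ v k → Edge M ⟨ v , zero ⟩ ⟨ v , suc k ⟩
  Edge-spoke v k = combine-monoʳ-< v (s≤s z≤n) , trans (M-orig-tri v v k) (==ᶠ-refl v)

  ¬Edge-tri-orig : ∀ {v i w} → ¬ Edge M ⟨ v , suc i ⟩ ⟨ w , zero ⟩
  ¬Edge-tri-orig {v} {i} {w} (lt , vw) with ==ᶠ⇒≡ (trans (sym (M-tri-orig v i w)) vw)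
  ... | refl with combine-<⇒ v (suc i) v zero lt
  ...   | inj₁ v<v     = ℕ.<-irrefl refl v<v
  ...   | inj₂ (_ , ())

  Edge-tri-tri⇒ : ∀ {v i w k} → Edge M ⟨ v , suc i ⟩ ⟨ w , suc k ⟩ →
                  w ≡ v × block i ≡ block k × side i ≡ zero × side k ≡ suc zero
  Edge-tri-tri⇒ {v} {i} {w} {k} (lt , vw) with M-tri-tri⇒ v i w k vw
  ... | refl , (i~k , _) with combine-<⇒ v (suc i) v (suc k) lt
  ...   | inj₁ v<v           = ⊥-elim (ℕ.<-irrefl refl v<v)
  ...   | inj₂ (_ , s≤s i<k) = refl , i~k , side-<⇒ i~k i<k

  Edge-base : ∀ v → Edge M ⟨ v , suc zero ⟩ ⟨ v , suc (suc zero) ⟩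
  Edge-base v = combine-monoʳ-< v (s≤s (s≤s z≤n)) , M-tri-tri-intro v zero (suc zero) (refl , λ ())

  sameEdgeOrbit-⟨⟩⇒ : ∀ {a i b k v j w l} → SameEdgeOrbit M ⟨ a , i ⟩ ⟨ b , k ⟩ ⟨ v , j ⟩ ⟨ w , l ⟩ →
    SameEdgeOrbit G a b v w ×
    ((isOriginal i ≡ isOriginal j × isOriginal k ≡ isOriginal l) ⊎
     (isOriginal i ≡ isOriginal l × isOriginal k ≡ isOriginal j))
  sameEdgeOrbit-⟨⟩⇒ (f , aut , inj₁ (fa , fb)) =
    let fa′ , ij = automorphism-⟨⟩ aut fa ; fb′ , kl = automorphism-⟨⟩ aut fb in
    (baseMap f , Restriction.baseMap-automorphism aut , inj₁ (fa′ , fb′)) , inj₁ (ij , kl)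
  sameEdgeOrbit-⟨⟩⇒ (f , aut , inj₂ (fa , fb)) =
    let fa′ , il = automorphism-⟨⟩ aut fa ; fb′ , kj = automorphism-⟨⟩ aut fb in
    (baseMap f , Restriction.baseMap-automorphism aut , inj₂ (fa′ , fb′)) , inj₂ (il , kj)

  sameEdgeOrbit-orig-intro : ∀ {a b v w} → SameEdgeOrbit G a b v w →
                             SameEdgeOrbit M ⟨ a , zero ⟩ ⟨ b , zero ⟩ ⟨ v , zero ⟩ ⟨ w , zero ⟩
  sameEdgeOrbit-orig-intro {a} {b} (σ , σ-aut , images) =
    transportLift σ zero zero , transportLift-automorphism σ-aut zero zero , lifted images
    where
    orig : ∀ {x y} → σ x ≡ y → transportLift σ zero zero ⟨ x , zero ⟩ ≡ ⟨ y , zero ⟩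
    orig {x} eq = trans (transportLift-original σ zero zero x) (cong ⟨_, zero ⟩ eq)
    lifted : _ ⊎ _ → _ ⊎ _
    lifted (inj₁ (σa , σb)) = inj₁ (orig σa , orig σb)
    lifted (inj₂ (σa , σb)) = inj₂ (orig σa , orig σb)

  -- The edge-orbit representatives are the lifted representatives of G and, for each
  -- vertex representative v, the spoke ⟨ v , 0 ⟩ ⟨ v , 1 ⟩ and the base ⟨ v , 1 ⟩ ⟨ v , 2 ⟩.
  edgeRep-orig-orig : ∀ v w → isEdgeOrbitRep M ⟨ v , zero ⟩ ⟨ w , zero ⟩ ≡ isEdgeOrbitRep G v w
  edgeRep-orig-orig v w = bool-ext down up
    where
    down : isEdgeOrbitRep M ⟨ v , zero ⟩ ⟨ w , zero ⟩ ≡ true → isEdgeOrbitRep G v w ≡ true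
    down e with isEdgeOrbitRep⇒ M _ _ e
    ... | vw , least = isEdgeOrbitRep-intro G v w (Edge-orig-orig⇒ vw) λ a b ab lex same →
      least _ _ (Edge-orig-orig-intro ab) (lift-lex lex) (sameEdgeOrbit-orig-intro same)
      where
      lift-lex : ∀ {a b} → LexLt G a b v w → LexLt M ⟨ a , zero ⟩ ⟨ b , zero ⟩ ⟨ v , zero ⟩ ⟨ w , zero ⟩
      lift-lex (inj₁ a<v)          = inj₁ (Fin.combine-monoˡ-< zero zero a<v)
      lift-lex (inj₂ (refl , b<w)) = inj₂ (refl , Fin.combine-monoˡ-< zero zero b<w)
    up : isEdgeOrbitRep G v w ≡ true → isEdgeOrbitRep M ⟨ v , zero ⟩ ⟨ w , zero ⟩ ≡ true
    up e with isEdgeOrbitRep⇒ G v w e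
    ... | vw , least = isEdgeOrbitRep-intro M _ _ (Edge-orig-orig-intro vw) (⟨⟩-elim₂ _ smaller)
      where
      lower-lex : ∀ {a b} → LexLt M ⟨ a , zero ⟩ ⟨ b , zero ⟩ ⟨ v , zero ⟩ ⟨ w , zero ⟩ → LexLt G a b v w
      lower-lex {a} {b} (inj₁ lt) with combine-<⇒ a zero v zero lt
      ... | inj₁ a<v     = inj₁ a<v
      ... | inj₂ (_ , ())
      lower-lex {a} {b} (inj₂ (eq , lt)) with combine-<⇒ b zero w zero lt
      ... | inj₁ b<w     = inj₂ (proj₁ (⟨⟩-injective eq) , b<w)
      ... | inj₂ (_ , ())
      smaller : ∀ a i b k → Edge M ⟨ a , i ⟩ ⟨ b , k ⟩ → LexLt M ⟨ a , i ⟩ ⟨ b , k ⟩ ⟨ v , zero ⟩ ⟨ w , zero ⟩ →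
                ¬ SameEdgeOrbit M ⟨ a , i ⟩ ⟨ b , k ⟩ ⟨ v , zero ⟩ ⟨ w , zero ⟩
      smaller a i b k ab lex same with sameEdgeOrbit-⟨⟩⇒ same
      smaller a zero    b zero    ab lex same | sameG , _ = least a b (Edge-orig-orig⇒ ab) (lower-lex lex) sameG
      smaller a zero    b (suc k) ab lex same | _ , inj₁ (_ , ())
      smaller a zero    b (suc k) ab lex same | _ , inj₂ (_ , ())
      smaller a (suc i) b k       ab lex same | _ , inj₁ (() , _)
      smaller a (suc i) b k       ab lex same | _ , inj₂ (() , _)

  edgeRep-tri-orig : ∀ v i w → isEdgeOrbitRep M ⟨ v , suc i ⟩ ⟨ w , zero ⟩ ≡ false
  edgeRep-tri-orig v i w = isEdgeOrbitRep-nonEdge M _ _ ¬Edge-tri-orig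

  edgeRep-spoke⇒ : ∀ v w k → isEdgeOrbitRep M ⟨ v , zero ⟩ ⟨ w , suc k ⟩ ≡ true →
                   w ≡ v × k ≡ zero × VertexOrbitRep G v
  edgeRep-spoke⇒ v w k e with isEdgeOrbitRep⇒ M _ _ e
  ... | vw , least with Edge-orig-tri⇒ vw
  ...   | refl = refl , first-spoke k least , rep
    where
    first-spoke : ∀ k → LeastInEdgeOrbit M ⟨ v , zero ⟩ ⟨ v , suc k ⟩ → k ≡ zero
    first-spoke zero    _     = refl
    first-spoke (suc k) least = ⊥-elim (least _ _ (Edge-spoke v zero)
      (inj₂ (refl , combine-monoʳ-< v (s≤s (s≤s z≤n))))
      (transportLift id zero (suc k) , transportLift-automorphism (id-automorphism G) zero (suc k) ,
       inj₁ (transportLift-original id zero (suc k) v , transportLift-source id zero (suc k) v)))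
    rep : VertexOrbitRep G v
    rep u u<v (σ , σ-aut , σu≡v) = least _ _ (Edge-spoke u k) (inj₁ (Fin.combine-monoˡ-< zero zero u<v))
      (transportLift σ k k , transportLift-automorphism σ-aut k k ,
       inj₁ (trans (transportLift-original σ k k u) (cong ⟨_, zero ⟩ σu≡v) ,
             trans (transportLift-source σ k k u) (cong ⟨_, suc k ⟩ σu≡v)))

  edgeRep-spoke-intro : ∀ v → VertexOrbitRep G v → isEdgeOrbitRep M ⟨ v , zero ⟩ ⟨ v , suc zero ⟩ ≡ true
  edgeRep-spoke-intro v rep = isEdgeOrbitRep-intro M _ _ (Edge-spoke v zero) (⟨⟩-elim₂ _ smaller)
    where
    smaller : ∀ a i b j → Edge M ⟨ a , i ⟩ ⟨ b , j ⟩ → LexLt M ⟨ a , i ⟩ ⟨ b , j ⟩ ⟨ v , zero ⟩ ⟨ v , suc zero ⟩ →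
              ¬ SameEdgeOrbit M ⟨ a , i ⟩ ⟨ b , j ⟩ ⟨ v , zero ⟩ ⟨ v , suc zero ⟩
    smaller a i b j ab lex same with sameEdgeOrbit-⟨⟩⇒ same
    smaller a (suc i) b zero    ab lex same | _ = ¬Edge-tri-orig ab
    smaller a (suc i) b (suc j) ab lex same | _ , inj₁ (() , _)
    smaller a (suc i) b (suc j) ab lex same | _ , inj₂ (_ , ())
    smaller a zero    b zero    ab lex same | _ , inj₁ (_ , ())
    smaller a zero    b zero    ab lex same | _ , inj₂ (() , _)
    smaller a zero    b (suc j) ab lex same | sameG , _ with Edge-orig-tri⇒ ab | lex
    ... | refl | inj₁ lt with combine-<⇒ a zero v zero lt
    ...   | inj₁ a<v     = [ rep a a<v , rep a a<v ] (SameEdgeOrbit⇒SameVertexOrbit G sameG)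
    ...   | inj₂ (_ , ())
    smaller a zero b (suc j) ab lex same | sameG , _ | refl | inj₂ (eq , lt)
      with refl ← proj₁ (⟨⟩-injective eq) with combine-<⇒ a (suc j) a (suc zero) lt
    ...   | inj₁ a<a           = ℕ.<-irrefl refl a<a
    ...   | inj₂ (_ , s≤s ())

  edgeRep-spoke : ∀ v w k → isEdgeOrbitRep M ⟨ v , zero ⟩ ⟨ w , suc k ⟩ ≡
                  (w ==ᶠ v) ∧ (k ==ᶠ zero) ∧ isVertexOrbitRep G v
  edgeRep-spoke v w k = bool-ext
    (λ e → let w≡v , k≡0 , rep = edgeRep-spoke⇒ v w k e in
      ∧-intro (≡⇒==ᶠ w≡v) (∧-intro (≡⇒==ᶠ k≡0) (isVertexOrbitRep-intro G v rep)))
    (λ e → let rest = ∧-elimʳ (w ==ᶠ v) e in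
      intro (==ᶠ⇒≡ (∧-elimˡ (w ==ᶠ v) e)) (==ᶠ⇒≡ (∧-elimˡ (k ==ᶠ zero) rest)) (∧-elimʳ (k ==ᶠ zero) rest))
    where
    intro : w ≡ v → k ≡ zero → isVertexOrbitRep G v ≡ true →
            isEdgeOrbitRep M ⟨ v , zero ⟩ ⟨ w , suc k ⟩ ≡ true
    intro refl refl rep = edgeRep-spoke-intro v (isVertexOrbitRep⇒ G v rep)

  base-first : ∀ v {i k} → block i ≡ block k → side i ≡ zero → side k ≡ suc zero →
               LeastInEdgeOrbit M ⟨ v , suc i ⟩ ⟨ v , suc k ⟩ → i ≡ zero × k ≡ suc zero
  base-first v {i} {k} i~k si sk least =
    block-side-injective block₀ si , block-side-injective (trans (sym i~k) block₀) sk
    where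
    k≡partner : k ≡ partner i
    k≡partner = ≡partner {i} {k} i~k (λ i≡k → zero≢one (trans (sym si) (trans (cong side i≡k) sk)))
      where
      zero≢one : zero {1} ≢ suc zero
      zero≢one ()
    positive : ∀ {j} → block j ≢ zero → 0 < toℕ j
    positive {zero}  b≢0 = ⊥-elim (b≢0 refl)
    positive {suc j} _   = s≤s z≤n
    block₀ : block i ≡ zero
    block₀ with block i Fin.≟ zero
    ... | yes b≡0 = b≡0
    ... | no  b≢0 = ⊥-elim (least _ _ (Edge-base v) (inj₁ (combine-monoʳ-< v (s≤s (positive {i} b≢0))))
      (transportLift id zero i , transportLift-automorphism (id-automorphism G) zero i ,
       inj₁ (transportLift-source id zero i v ,
             trans (transportLift-triangle id zero i v (suc zero))
                   (cong (λ x → ⟨ v , suc x ⟩) (trans (transport-partner zero i) (sym k≡partner))))))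

  base-rep : ∀ v → LeastInEdgeOrbit M ⟨ v , suc zero ⟩ ⟨ v , suc (suc zero) ⟩ → VertexOrbitRep G v
  base-rep v least u u<v (σ , σ-aut , σu≡v) = least _ _ (Edge-base u) (inj₁ (Fin.combine-monoˡ-< _ _ u<v))
    (transportLift σ zero zero , transportLift-automorphism σ-aut zero zero ,
     inj₁ (trans (transportLift-source σ zero zero u) (cong ⟨_, suc zero ⟩ σu≡v) ,
           trans (transportLift-triangle σ zero zero u (suc zero))
                 (cong₂ (λ a x → ⟨ a , suc x ⟩) σu≡v (transport-partner zero zero))))

  edgeRep-base⇒ : ∀ v i w k → isEdgeOrbitRep M ⟨ v , suc i ⟩ ⟨ w , suc k ⟩ ≡ true →
                  w ≡ v × i ≡ zero × k ≡ suc zero × VertexOrbitRep G v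
  edgeRep-base⇒ v i w k e with isEdgeOrbitRep⇒ M _ _ e
  ... | vw , least with Edge-tri-tri⇒ vw
  ...   | refl , i~k , si , sk with base-first v i~k si sk least
  ...     | refl , refl = refl , refl , refl , base-rep v least

  edgeRep-base-intro : ∀ v → VertexOrbitRep G v →
                       isEdgeOrbitRep M ⟨ v , suc zero ⟩ ⟨ v , suc (suc zero) ⟩ ≡ true
  edgeRep-base-intro v rep = isEdgeOrbitRep-intro M _ _ (Edge-base v) (⟨⟩-elim₂ _ smaller)
    where
    smaller : ∀ a i b j → Edge M ⟨ a , i ⟩ ⟨ b , j ⟩ →
              LexLt M ⟨ a , i ⟩ ⟨ b , j ⟩ ⟨ v , suc zero ⟩ ⟨ v , suc (suc zero) ⟩ →
              ¬ SameEdgeOrbit M ⟨ a , i ⟩ ⟨ b , j ⟩ ⟨ v , suc zero ⟩ ⟨ v , suc (suc zero) ⟩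
    smaller a i b j ab lex same with sameEdgeOrbit-⟨⟩⇒ same
    smaller a zero    b j       ab lex same | _ , inj₁ (() , _)
    smaller a zero    b j       ab lex same | _ , inj₂ (() , _)
    smaller a (suc i) b zero    ab lex same | _ = ¬Edge-tri-orig ab
    smaller a (suc i) b (suc j) ab lex same | sameG , _ with Edge-tri-tri⇒ ab | lex
    ... | refl , _ , _ , sj | inj₁ lt with combine-<⇒ a (suc i) v (suc zero) lt
    ...   | inj₁ a<v          = [ rep a a<v , rep a a<v ] (SameEdgeOrbit⇒SameVertexOrbit G sameG)
    ...   | inj₂ (_ , s≤s ())
    smaller a (suc i) b (suc j) ab lex same | sameG , _ | refl , _ , _ , sj | inj₂ (eq , lt)
      with refl ← proj₁ (⟨⟩-injective eq) with combine-<⇒ a (suc j) a (suc (suc zero)) lt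
    ...   | inj₁ a<a                = ℕ.<-irrefl refl a<a
    ...   | inj₂ (_ , s≤s j<1) with refl ← Fin.toℕ-injective {i = j} {j = zero} (ℕ.n<1⇒n≡0 j<1) with () ← sj

  edgeRep-base : ∀ v i w k → isEdgeOrbitRep M ⟨ v , suc i ⟩ ⟨ w , suc k ⟩ ≡
                 (w ==ᶠ v) ∧ (i ==ᶠ zero) ∧ (k ==ᶠ suc zero) ∧ isVertexOrbitRep G v
  edgeRep-base v i w k = bool-ext
    (λ e → let w≡v , i≡0 , k≡1 , rep = edgeRep-base⇒ v i w k e in
      ∧-intro (≡⇒==ᶠ w≡v) (∧-intro (≡⇒==ᶠ i≡0) (∧-intro (≡⇒==ᶠ k≡1) (isVertexOrbitRep-intro G v rep))))
    (λ e → let e₁ = ∧-elimʳ (w ==ᶠ v) e ; e₂ = ∧-elimʳ (i ==ᶠ zero) e₁ in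
      intro (==ᶠ⇒≡ (∧-elimˡ (w ==ᶠ v) e)) (==ᶠ⇒≡ (∧-elimˡ (i ==ᶠ zero) e₁))
            (==ᶠ⇒≡ (∧-elimˡ (k ==ᶠ suc zero) e₂)) (∧-elimʳ (k ==ᶠ suc zero) e₂))
    where
    intro : w ≡ v → i ≡ zero → k ≡ suc zero → isVertexOrbitRep G v ≡ true →
            isEdgeOrbitRep M ⟨ v , suc i ⟩ ⟨ w , suc k ⟩ ≡ true
    intro refl refl refl rep = edgeRep-base-intro v (isVertexOrbitRep⇒ G v rep)

  edgeReps-original : ∀ v → countFin N (isEdgeOrbitRep M ⟨ v , zero ⟩) ≡
                      countFin n (isEdgeOrbitRep G v) + indicator (isVertexOrbitRep G v)
  edgeReps-original v = begin
    countFin N (isEdgeOrbitRep M ⟨ v , zero ⟩)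
      ≡⟨ countFin-combine n K _ ⟩
    sumFin n (λ w → countFin K (λ k → isEdgeOrbitRep M ⟨ v , zero ⟩ ⟨ w , k ⟩))
      ≡⟨ sumFin-cong n at ⟩
    sumFin n (λ w → indicator (isEdgeOrbitRep G v w) + indicator ((w ==ᶠ v) ∧ r))
      ≡⟨ sumFin-+ n _ _ ⟩
    sumFin n (λ w → indicator (isEdgeOrbitRep G v w)) + sumFin n (λ w → indicator ((w ==ᶠ v) ∧ r))
      ≡⟨ cong₂ _+_ (sym (countFin≡sumFin n _))
                   (trans (sym (countFin≡sumFin n _)) (countFin-at n v (_∧ r) refl)) ⟩
    countFin n (isEdgeOrbitRep G v) + indicator r ∎
    where
    open ≡-Reasoning
    r = isVertexOrbitRep G v
    at : ∀ w → countFin K (λ k → isEdgeOrbitRep M ⟨ v , zero ⟩ ⟨ w , k ⟩) ≡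
               indicator (isEdgeOrbitRep G v w) + indicator ((w ==ᶠ v) ∧ r)
    at w = cong₂ _+_ (cong indicator (edgeRep-orig-orig v w))
      (trans (countFin-cong T (edgeRep-spoke v w)) (countFin-at T zero (λ b → (w ==ᶠ v) ∧ b ∧ r) (∧-zeroʳ _)))

  edgeReps-triangle : ∀ v i → countFin N (isEdgeOrbitRep M ⟨ v , suc i ⟩) ≡
                      indicator ((i ==ᶠ zero) ∧ isVertexOrbitRep G v)
  edgeReps-triangle v i = begin
    countFin N (isEdgeOrbitRep M ⟨ v , suc i ⟩)
      ≡⟨ countFin-combine n K _ ⟩
    sumFin n (λ w → countFin K (λ k → isEdgeOrbitRep M ⟨ v , suc i ⟩ ⟨ w , k ⟩))
      ≡⟨ sumFin-cong n at ⟩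
    sumFin n (λ w → indicator ((w ==ᶠ v) ∧ (i ==ᶠ zero) ∧ r))
      ≡⟨ trans (sym (countFin≡sumFin n _)) (countFin-at n v (_∧ (i ==ᶠ zero) ∧ r) refl) ⟩
    indicator ((i ==ᶠ zero) ∧ r) ∎
    where
    open ≡-Reasoning
    r = isVertexOrbitRep G v
    at : ∀ w → countFin K (λ k → isEdgeOrbitRep M ⟨ v , suc i ⟩ ⟨ w , k ⟩) ≡
               indicator ((w ==ᶠ v) ∧ (i ==ᶠ zero) ∧ r)
    at w = cong₂ _+_ (cong indicator (edgeRep-tri-orig v i w))
      (trans (countFin-cong T (edgeRep-base v i w))
             (countFin-at T (suc zero) (λ b → (w ==ᶠ v) ∧ (i ==ᶠ zero) ∧ b ∧ r)
               (trans (cong ((w ==ᶠ v) ∧_) (∧-zeroʳ _)) (∧-zeroʳ _))))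

  edgeReps-at : ∀ v → sumFin K (λ i → countFin N (isEdgeOrbitRep M ⟨ v , i ⟩)) ≡
                countFin n (isEdgeOrbitRep G v) + 2 * indicator (isVertexOrbitRep G v)
  edgeReps-at v = begin
    sumFin K (λ i → countFin N (isEdgeOrbitRep M ⟨ v , i ⟩))
      ≡⟨ cong₂ _+_ (edgeReps-original v) (sumFin-cong T (edgeReps-triangle v)) ⟩
    c + r + sumFin T (λ i → indicator ((i ==ᶠ zero) ∧ isVertexOrbitRep G v))
      ≡⟨ cong (c + r +_) (trans (sym (countFin≡sumFin T (λ i → (i ==ᶠ zero) ∧ isVertexOrbitRep G v)))
                                (countFin-at T zero (_∧ isVertexOrbitRep G v) refl)) ⟩
    c + r + r   ≡⟨ ℕ.+-assoc c r r ⟩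
    c + (r + r) ≡⟨ cong (λ x → c + (r + x)) (sym (ℕ.+-identityʳ r)) ⟩
    c + 2 * r   ∎
    where
    open ≡-Reasoning
    c = countFin n (isEdgeOrbitRep G v)
    r = indicator (isVertexOrbitRep G v)

  edgeOrbits-M3 : edgeOrbits M ≡ edgeOrbits G + 2 * vertexOrbits G
  edgeOrbits-M3 = begin
    edgeOrbits M
      ≡⟨ sumFin-combine n K _ ⟩
    sumFin n (λ v → sumFin K (λ i → countFin N (isEdgeOrbitRep M ⟨ v , i ⟩)))
      ≡⟨ sumFin-cong n edgeReps-at ⟩
    sumFin n (λ v → countFin n (isEdgeOrbitRep G v) + 2 * indicator (isVertexOrbitRep G v))
      ≡⟨ sumFin-+ n _ _ ⟩
    edgeOrbits G + sumFin n (λ v → 2 * indicator (isVertexOrbitRep G v))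
      ≡⟨ cong (edgeOrbits G +_) (trans (sumFin-*ˡ n 2 _) (cong (2 *_) (sym (countFin≡sumFin n _)))) ⟩
    edgeOrbits G + 2 * vertexOrbits G ∎
    where open ≡-Reasoning

proposition30 : (t : ℕ) → t ≥ 1 → (n : ℕ) → (G : Adj n) →
    IsSimpleGraph G → Connected G → Regular (2 * t) G →
    (vertexOrbits (M3 t G) ≡ 2 * vertexOrbits G)
    × (edgeOrbits (M3 t G) ≡ edgeOrbits G + 2 * vertexOrbits G)
    × (autOrder (M3 t G) ≡ ((2 ^ t) * (t !)) ^ n * autOrder G)
proposition30 (suc t′) (s≤s z≤n) n G simple _ regular = vertexOrbits-M3 , edgeOrbits-M3 , autOrder-M3
  where
  neighbour : ∀ v → ∃[ w ] G v w ≡ true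
  neighbour v = countFin-nonzero n (G v) (λ degree≡0 → ℕ.1+n≢0 (trans (sym (regular v)) degree≡0))

  open Fused t′ n G (IsSimpleGraph.loopless simple) neighbour

  autOrder-M3 : autOrder M ≡ ((2 ^ t) * (t !)) ^ n * autOrder G
  autOrder-M3 = begin
    autOrder M                                         ≡⟨ length-filterᵇ (isAut M) (allFuns N N) ⟩
    count (isAut M) (allFuns N N)                      ≡⟨ count-automorphisms ⟩
    count (isAut G) (allFuns n n) * (t ! * 2 ^ t) ^ n  ≡⟨ ℕ.*-comm _ ((t ! * 2 ^ t) ^ n) ⟩
    (t ! * 2 ^ t) ^ n * count (isAut G) (allFuns n n)  ≡⟨ cong₂ _*_ (cong (_^ n) (ℕ.*-comm (t !) (2 ^ t)))
                                                                    (sym (length-filterᵇ (isAut G) (allFuns n n))) ⟩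
    (2 ^ t * t !) ^ n * autOrder G                     ∎
    where open ≡-Reasoning
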